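{- Let $\mathbf{M}_1$ be a partition matroid with all-one upper bounds, let $I\in\mathcal{I}_1^k\cap\mathcal{I}_2^k$, and let $s\in E\setminus I$. Run the following procedure, which uses only the common independence oracle. Step 1: if $I+s\in\mathcal{I}_1\cap\mathcal{I}_2$, return the sequence $(s)$. Step 2: for each $y\in I$, set $P_y\gets(s,y)$ if $I+s-y\in\mathcal{I}_1\cap\mathcal{I}_2$ and $P_y\gets\mathsf{null}$ otherwise. Step 3: for $\ell=1,2,\dots$: (i) if there is no $y\in I$ with $|P_y|=2\ell$, return ``No''; (ii) if there exist $y'\in I$ and $x\in E\setminus I$ with $|P_{y'}|=2\ell$, $x\notin P_{y'}$, $\{y',x\}\notin\mathcal{I}_1\cap\mathcal{I}_2$ and $I\triangle(P_{y'}+x)\in\mathcal{I}_1\cap\mathcal{I}_2$, return $P_{y'}+x$; (iii) for each $y\in I$ with $P_y=\mathsf{null}$, if there exist $y'\in I$ and $x\in E\setminus I$ with $|P_{y'}|=2\ell$, $x\notin P_{y'}$, $\{y',x\}\notin\mathcal{I}_1\cap\mathcal{I}_2$ and $I\triangle(P_{y'}+x+y)\in\mathcal{I}_1\cap\mathcal{I}_2$, set $P_y\gets P_{y'}+x+y$. Then the output is correct: it is either ``No'' or a sequence $P$ with $I\triangle P\in\mathcal{I}_1\cap\mathcal{I}_2$ and $|I\triangle P|=k+1$; and if $s\in S_I$ and $D'[I]$ contains a path from $s$ to $T_I$, then a shortest $s$--$T_I$ path in $D'[I]$ is returned.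
   Context: $\mathbf{M}_1=(E,\mathcal{I}_1)$, $\mathbf{M}_2=(E,\mathcal{I}_2)$ are loopless matroids on a finite set $E$, $|E|=n$; $\mathbf{M}_1$ is a partition matroid with all-one upper bounds, i.e., $\mathcal{I}_1=\{X\subseteq E:|X\cap E_i|\le1 \text{ for } i=1,\dots,q\}$ for a partition $E=E_1\cup\dots\cup E_q$. $\mathcal{I}_i^k=\{X\in\mathcal{I}_i:|X|=k\}$. For $I\in\mathcal{I}_1\cap\mathcal{I}_2$: $S_I=\{s\in E\setminus I: I+s\in\mathcal{I}_1\}$, $T_I=\{t\in E\setminus I: I+t\in\mathcal{I}_2\}$; $A_1[I]=\{(y,x): x\in E\setminus I,\ y\in I,\ I+x-y\in\mathcal{I}_1\}$, $A_2[I]=\{(x,y): x\in E\setminus I,\ y\in I,\ I+x-y\in\mathcal{I}_2\}$; $D'[I]$ is the digraph on $E$ whose arcs are the arcs of $A_1[I]$ with head not in $S_I$ together with the arcs of $A_2[I]$ with tail not in $T_I$. A path is a sequence of distinct vertices whose consecutive pairs are arcs; its length is its number of vertices; a shortest $s$--$T_I$ path is a path from $s$ to a vertex of $T_I$ of minimum length. $|P|$ is the number of elements of a sequence $P$, $P+e$ appends $e$ to $P$, and $I\triangle P$ is the symmetric difference of $I$ with the set of elements of $P$. -}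

module Defs where

open import Data.Nat using (ℕ; zero; suc; _+_; _*_; _≤_; _<_)
open import Data.Bool using (Bool; true; false; _xor_)
open import Data.Fin using (Fin) renaming (_≟_ to _≟ᶠ_)
open import Data.Fin.Subset using (Subset; _∈_; _∉_; _⊆_; ⊥; ⁅_⁆; _∪_; _∩_; _-_; ∣_∣; ⋃)
open import Data.Vec using (zipWith; tabulate)
open import Data.List using (List; []; _∷_; _++_; [_]; length; last; map)
open import Data.List.Relation.Unary.Unique.Propositional using (Unique)
open import Data.List.Relation.Unary.Linked using (Linked)
import Data.List.Membership.Propositional as L
open import Data.Maybe using (Maybe; just; nothing)
open import Data.Product using (Σ; ∃; ∃-syntax; _×_; _,_)
open import Data.Sum using (_⊎_)
open import Relation.Nullary using (¬_; Dec; does)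
open import Relation.Binary.PropositionalEquality using (_≡_)
open import Function.Bundles using (_⇔_)

record Matroid (n : ℕ) : Set₁ where
  field
    Indep   : Subset n → Set
    indep?  : ∀ X → Dec (Indep X)
    indep-⊥ : Indep ⊥
    indep-↓ : ∀ {X Y} → X ⊆ Y → Indep Y → Indep X
    indep-aug : ∀ {X Y} → Indep X → Indep Y → ∣ X ∣ < ∣ Y ∣ →
                ∃[ e ] (e ∈ Y × e ∉ X × Indep (⁅ e ⁆ ∪ X))

open Matroid public

Loopless : ∀ {n} → Matroid n → Set
Loopless M = ∀ e → Indep M ⁅ e ⁆

Class : ∀ {n q} → (Fin n → Fin q) → Fin q → Subset n
Class part i = tabulate (λ e → does (part e ≟ᶠ i))

IsPartitionAllOne : ∀ {n} → Matroid n → Set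
IsPartitionAllOne {n} M =
  ∃[ q ] Σ (Fin n → Fin q) λ part →
    ∀ X → Indep M X ⇔ (∀ i → ∣ X ∩ Class part i ∣ ≤ 1)

elems : ∀ {n} → List (Fin n) → Subset n
elems P = ⋃ (map ⁅_⁆ P)

_△_ : ∀ {n} → Subset n → Subset n → Subset n
X △ Y = zipWith _xor_ X Y

_△ₗ_ : ∀ {n} → Subset n → List (Fin n) → Subset n
X △ₗ P = X △ elems P

_＋_ : ∀ {n} → Subset n → Fin n → Subset n
X ＋ e = ⁅ e ⁆ ∪ X

data Outcome (n : ℕ) : Set where
  No  : Outcome n
  ret : List (Fin n) → Outcome n

module Setup {n : ℕ} (M₁ M₂ : Matroid n) (I : Subset n) (s : Fin n) where

  CI : Subset n → Set
  CI X = Indep M₁ X × Indep M₂ X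

  S_I : Fin n → Set
  S_I x = x ∉ I × Indep M₁ (I ＋ x)

  T_I : Fin n → Set
  T_I x = x ∉ I × Indep M₂ (I ＋ x)

  A₁ : Fin n → Fin n → Set
  A₁ y x = x ∉ I × y ∈ I × Indep M₁ (I ＋ x - y)

  A₂ : Fin n → Fin n → Set
  A₂ x y = x ∉ I × y ∈ I × Indep M₂ (I ＋ x - y)

  D′ : Fin n → Fin n → Set
  D′ u v = (A₁ u v × ¬ S_I v) ⊎ (A₂ u v × ¬ T_I u)

  STPath : List (Fin n) → Set
  STPath P = (∃[ rest ] P ≡ s ∷ rest) × Unique P × Linked D′ P ×
             (∃[ t ] (last P ≡ just t × T_I t))

  ShortestSTPath : List (Fin n) → Set
  ShortestSTPath P = STPath P × (∀ Q → STPath Q → length P ≤ length Q)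

  -- The procedure, as a (nondeterministic) relation.
  -- State: y ↦ P_y, with nothing = null.

  State : Set
  State = Fin n → Maybe (List (Fin n))

  Init : State → Set
  Init P = ∀ y → (y ∈ I × CI (I ＋ s - y) × P y ≡ just (s ∷ y ∷ []))
               ⊎ (¬ (y ∈ I × CI (I ＋ s - y)) × P y ≡ nothing)

  HasLen : ℕ → State → Fin n → Set
  HasLen ℓ P y = ∃[ Q ] (P y ≡ just Q × length Q ≡ 2 * ℓ)

  Base : ℕ → State → Fin n → Fin n → List (Fin n) → Set
  Base ℓ P y′ x Q = y′ ∈ I × x ∉ I × P y′ ≡ just Q × length Q ≡ 2 * ℓ ×
                    ¬ (x L.∈ Q) × ¬ CI (⁅ y′ ⁆ ∪ ⁅ x ⁆)

  Cond-ii : ℕ → State → Fin n → Fin n → List (Fin n) → Set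
  Cond-ii ℓ P y′ x Q = Base ℓ P y′ x Q × CI (I △ₗ (Q ++ [ x ]))

  Cond-iii : ℕ → State → Fin n → Fin n → Fin n → List (Fin n) → Set
  Cond-iii ℓ P y y′ x Q = Base ℓ P y′ x Q × CI (I △ₗ (Q ++ x ∷ y ∷ []))

  data UpdAt (ℓ : ℕ) (P : State) (y : Fin n) : Maybe (List (Fin n)) → Set where
    keep : ¬ (y ∈ I × P y ≡ nothing) → UpdAt ℓ P y (P y)
    set  : y ∈ I → P y ≡ nothing → ∀ y′ x Q → Cond-iii ℓ P y y′ x Q →
           UpdAt ℓ P y (just (Q ++ x ∷ y ∷ []))
    stay : y ∈ I → P y ≡ nothing → ¬ (∃[ y′ ] ∃[ x ] ∃[ Q ] Cond-iii ℓ P y y′ x Q) →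
           UpdAt ℓ P y nothing

  data Loop (ℓ : ℕ) (P : State) : Outcome n → Set where
    step-i   : ¬ (∃[ y ] (y ∈ I × HasLen ℓ P y)) → Loop ℓ P No
    step-ii  : (∃[ y ] (y ∈ I × HasLen ℓ P y)) →
               ∀ y′ x Q → Cond-ii ℓ P y′ x Q → Loop ℓ P (ret (Q ++ [ x ]))
    step-iii : (∃[ y ] (y ∈ I × HasLen ℓ P y)) →
               ¬ (∃[ y′ ] ∃[ x ] ∃[ Q ] Cond-ii ℓ P y′ x Q) →
               ∀ P′ → (∀ y → UpdAt ℓ P y (P′ y)) →
               ∀ {out} → Loop (suc ℓ) P′ out → Loop ℓ P out

  data Run : Outcome n → Set where
    step-1 : CI (I ＋ s) → Run (ret [ s ])
    step-2-3 : ¬ CI (I ＋ s) → ∀ P → Init P → ∀ {out} → Loop 1 P out → Run out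

  Correct : ℕ → Outcome n → Set
  Correct k out =
    (out ≡ No ⊎ ∃[ P ] (out ≡ ret P × CI (I △ₗ P) × ∣ I △ₗ P ∣ ≡ suc k))
    × (S_I s → (∃[ Q ] STPath Q) → ∃[ P ] (out ≡ ret P × ShortestSTPath P))

-- Arcs of D′[I] alternate between E ∖ I and I: an arc y → x leaving I joins two elements of
-- one class of the partition matroid M₁, and an arc x → y entering I is an M₂-exchange
-- I + x - y.  Along any path from s ∈ S_I every entered element replaces the element of I of
-- its class, so I △ P stays M₁-independent; along a shortest path no arc shortcuts a later
-- exchange, so the M₂-circuits of I + x carry over to I △ (suffix) and I △ P stays
-- M₂-independent.  For shortest paths the oracle tests of steps (ii) and (iii) are therefore
-- exactly the arc conditions, and by induction on ℓ, after round ℓ, P_y is a shortest s–y path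
-- for every y ∈ I within distance 2ℓ, while T_I lies at distance > 2ℓ + 1.  Step (ii) fires at
-- the distance of T_I and step (i) only when T_I is unreachable; the size of I △ P follows
-- from the alternation, and every round that does not stop sets a new P_y.

module Submission where

open import Data.Bool using (true)
open import Data.Empty using (⊥-elim)
open import Data.Fin using (Fin; zero; suc) renaming (_≟_ to _≟ᶠ_)
import Data.Fin.Properties as Fin
open import Data.Fin.Subset
  using (Subset; _∈_; _∉_; _⊆_; ⊥; ⁅_⁆; _∪_; _∩_; _─_; _-_; ∣_∣; inside; outside)
open import Data.Fin.Subset.Properties
  using (_∈?_; x∈⁅x⁆; x∈⁅y⁆⇒x≡y; ∉⊥; x∈p∪q⁺; x∈p∪q⁻; x∈p∩q⁺; x∈p∩q⁻; ∪-identityˡ; ∣⁅x⁆∣≡1;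
         ∣⊥∣≡0; p⊆q⇒∣p∣≤∣q∣; p⊂q⇒∣p∣<∣q∣; x∈p∧x≢y⇒x∈p-y; x∈p⇒∣p-x∣<∣p∣; p─q⊆p; x∈p∧x∉q⇒x∈p─q;
         ⊆-antisym; nonempty?; Empty-unique)
open import Data.List using (List; []; _∷_; _++_; [_]; _∷ʳ_; length; last)
import Data.List.Properties as List
import Data.List.Membership.Propositional as L
import Data.List.Membership.DecPropositional
open import Data.List.Membership.Propositional.Properties using (∈-++⁻; ∈-++⁺ˡ; ∈-++⁺ʳ)
open import Data.List.Relation.Unary.All using ([]; _∷_)
import Data.List.Relation.Unary.All.Properties as All
open import Data.List.Relation.Unary.AllPairs using ([]; _∷_)
open import Data.List.Relation.Unary.Any using (here; there)
open import Data.List.Relation.Unary.Linked using (Linked; []; [-]; _∷_)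
open import Data.List.Relation.Unary.Unique.Propositional using (Unique)
open import Data.Maybe using (Maybe; just; nothing)
open import Data.Maybe.Properties using (just-injective)
open import Data.Nat using (ℕ; zero; suc; _+_; _*_; _≤_; _<_; _≤?_; z≤n; s≤s)
import Data.Nat.Properties as ℕ
open ℕ.≤-Reasoning hiding (start)
open import Data.Product using (∃-syntax; _×_; _,_; proj₁; proj₂)
open import Data.Sum using (_⊎_; inj₁; inj₂; [_,_]′)
open import Data.Vec using ([]; _∷_; _[_]=_)
open _[_]=_
open import Data.Vec.Properties using (lookup∘tabulate; lookup⇒[]=; []=⇒lookup)
open import Function using (_∘_; id; case_of_)
open import Function.Bundles using (_⇔_; module Equivalence)
open import Relation.Binary.PropositionalEquality
  using (_≡_; _≢_; refl; sym; trans; cong; subst)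
open import Relation.Nullary using (¬_; Dec; yes; no; does)
open import Relation.Nullary.Decidable using (dec-true; _×-dec_; ¬?)
import Relation.Nullary.Decidable as Dec

open import Defs

private variable
  n : ℕ

x∈p─q⇒x∉q : ∀ {x : Fin n} (p q : Subset n) → x ∈ p ─ q → x ∉ q
x∈p─q⇒x∉q {x = zero}  (_ ∷ p) (inside  ∷ q) ()        here
x∈p─q⇒x∉q {x = suc x} (_ ∷ p) (_       ∷ q) (there m) (there m′) = x∈p─q⇒x∉q p q m m′

x∈p-y⇒x≢y : ∀ {x y : Fin n} (p : Subset n) → x ∈ p - y → x ≢ y
x∈p-y⇒x≢y {y = y} p m refl = x∈p─q⇒x∉q p ⁅ y ⁆ m (x∈⁅x⁆ y)

x∈p-y⇒x∈p : ∀ {x y : Fin n} (p : Subset n) → x ∈ p - y → x ∈ p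
x∈p-y⇒x∈p {y = y} p = p─q⊆p p ⁅ y ⁆

x∈p△q⁻ : ∀ {x : Fin n} (p q : Subset n) → x ∈ p △ q → (x ∈ p × x ∉ q) ⊎ (x ∉ p × x ∈ q)
x∈p△q⁻ (inside  ∷ p) (outside ∷ q) here = inj₁ (here , λ ())
x∈p△q⁻ (outside ∷ p) (inside  ∷ q) here = inj₂ ((λ ()) , here)
x∈p△q⁻ (_ ∷ p) (_ ∷ q) (there m) with x∈p△q⁻ p q m
... | inj₁ (u , v) = inj₁ (there u , λ { (there w) → v w })
... | inj₂ (u , v) = inj₂ ((λ { (there w) → u w }) , there v)

x∈p△q⁺ˡ : ∀ {x : Fin n} (p q : Subset n) → x ∈ p → x ∉ q → x ∈ p △ q
x∈p△q⁺ˡ (inside ∷ p) (inside  ∷ q) here x∉q = ⊥-elim (x∉q here)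
x∈p△q⁺ˡ (inside ∷ p) (outside ∷ q) here _   = here
x∈p△q⁺ˡ (_ ∷ p) (_ ∷ q) (there m) x∉q = there (x∈p△q⁺ˡ p q m (λ w → x∉q (there w)))

x∈p△q⁺ʳ : ∀ {x : Fin n} (p q : Subset n) → x ∉ p → x ∈ q → x ∈ p △ q
x∈p△q⁺ʳ (inside  ∷ p) (inside ∷ q) x∉p here = ⊥-elim (x∉p here)
x∈p△q⁺ʳ (outside ∷ p) (inside ∷ q) _   here = here
x∈p△q⁺ʳ (_ ∷ p) (_ ∷ q) x∉p (there m) = there (x∈p△q⁺ʳ p q (λ w → x∉p (there w)) m)

x∈elems⁻ : ∀ {x : Fin n} (xs : List (Fin n)) → x ∈ elems xs → x L.∈ xs
x∈elems⁻ []       m = ⊥-elim (∉⊥ m)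
x∈elems⁻ (a ∷ xs) m with x∈p∪q⁻ ⁅ a ⁆ (elems xs) m
... | inj₁ u = here (x∈⁅y⁆⇒x≡y a u)
... | inj₂ u = there (x∈elems⁻ xs u)

x∈elems⁺ : ∀ {x : Fin n} (xs : List (Fin n)) → x L.∈ xs → x ∈ elems xs
x∈elems⁺ (a ∷ xs) (here refl) = x∈p∪q⁺ (inj₁ (x∈⁅x⁆ a))
x∈elems⁺ (a ∷ xs) (there m)   = x∈p∪q⁺ (inj₂ (x∈elems⁺ xs m))

x∈p＋y⁻ : ∀ {x y : Fin n} (p : Subset n) → x ∈ p ＋ y → x ≡ y ⊎ x ∈ p
x∈p＋y⁻ {y = y} p m with x∈p∪q⁻ ⁅ y ⁆ p m
... | inj₁ u = inj₁ (x∈⁅y⁆⇒x≡y y u)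
... | inj₂ u = inj₂ u

y∈p＋y : ∀ (y : Fin n) (p : Subset n) → y ∈ p ＋ y
y∈p＋y y p = x∈p∪q⁺ (inj₁ (x∈⁅x⁆ y))

x∈p⇒x∈p＋y : ∀ {x : Fin n} (y : Fin n) (p : Subset n) → x ∈ p → x ∈ p ＋ y
x∈p⇒x∈p＋y y p m = x∈p∪q⁺ (inj₂ m)

p⊆q⇒p＋x⊆q＋x : ∀ {p q : Subset n} {x} → p ⊆ q → p ＋ x ⊆ q ＋ x
p⊆q⇒p＋x⊆q＋x {p = p} {q} {x} p⊆q m = [ (λ { refl → y∈p＋y x q }) , x∈p⇒x∈p＋y x q ∘ p⊆q ]′ (x∈p＋y⁻ p m)

p＋x-y⊆p-y＋x : ∀ {p : Subset n} {x y} → p ＋ x - y ⊆ (p - y) ＋ x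
p＋x-y⊆p-y＋x {p = p} {x} {y} m with x∈p＋y⁻ p (x∈p-y⇒x∈p (p ＋ x) m)
... | inj₁ refl = y∈p＋y x (p - y)
... | inj₂ u    = x∈p⇒x∈p＋y x (p - y) (x∈p∧x≢y⇒x∈p-y u (x∈p-y⇒x≢y (p ＋ x) m))

∣p＋x∣≤1+∣p∣ : ∀ (x : Fin n) (p : Subset n) → ∣ p ＋ x ∣ ≤ suc ∣ p ∣
∣p＋x∣≤1+∣p∣ zero    (inside  ∷ p) rewrite ∪-identityˡ p = s≤s (ℕ.n≤1+n _)
∣p＋x∣≤1+∣p∣ zero    (outside ∷ p) rewrite ∪-identityˡ p = ℕ.≤-refl
∣p＋x∣≤1+∣p∣ (suc x) (inside  ∷ p) = s≤s (∣p＋x∣≤1+∣p∣ x p)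
∣p＋x∣≤1+∣p∣ (suc x) (outside ∷ p) = ∣p＋x∣≤1+∣p∣ x p

x∉p⇒∣p＋x∣≡1+∣p∣ : ∀ {x : Fin n} (p : Subset n) → x ∉ p → ∣ p ＋ x ∣ ≡ suc ∣ p ∣
x∉p⇒∣p＋x∣≡1+∣p∣ {x = x} p x∉p = ℕ.≤-antisym (∣p＋x∣≤1+∣p∣ x p)
  (p⊂q⇒∣p∣<∣q∣ (x∈p⇒x∈p＋y x p , x , y∈p＋y x p , x∉p))

x∈p⇒1+∣p-x∣≡∣p∣ : ∀ {x : Fin n} (p : Subset n) → x ∈ p → suc ∣ p - x ∣ ≡ ∣ p ∣
x∈p⇒1+∣p-x∣≡∣p∣ {x = x} p x∈p = ℕ.≤-antisym (x∈p⇒∣p-x∣<∣p∣ x∈p)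
  (ℕ.≤-trans (p⊆q⇒∣p∣≤∣q∣ p⊆p-x＋x) (∣p＋x∣≤1+∣p∣ x (p - x)))
  where
  p⊆p-x＋x : p ⊆ (p - x) ＋ x
  p⊆p-x＋x {y} y∈p with y ≟ᶠ x
  ... | yes refl = y∈p＋y x (p - x)
  ... | no  y≢x  = x∈p⇒x∈p＋y x (p - x) (x∈p∧x≢y⇒x∈p-y y∈p y≢x)

△ₗ-[] : (p : Subset n) → p △ₗ [] ≡ p
△ₗ-[] p = ⊆-antisym ⊆p (λ m → x∈p△q⁺ˡ p ⊥ m ∉⊥)
  where
  ⊆p : p △ₗ [] ⊆ p
  ⊆p m with x∈p△q⁻ p ⊥ m
  ... | inj₁ (u , _) = u
  ... | inj₂ (_ , v) = ⊥-elim (∉⊥ v)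

x∈elems-∷ʳ⁻ : ∀ {x a : Fin n} (xs : List (Fin n)) → x ∈ elems (xs ∷ʳ a) → x L.∈ xs ⊎ x ≡ a
x∈elems-∷ʳ⁻ xs m with ∈-++⁻ xs (x∈elems⁻ (xs ∷ʳ _) m)
... | inj₁ u        = inj₁ u
... | inj₂ (here e) = inj₂ e

x∈elems-∷ʳ⁺ˡ : ∀ {x a : Fin n} (xs : List (Fin n)) → x ∈ elems xs → x ∈ elems (xs ∷ʳ a)
x∈elems-∷ʳ⁺ˡ {a = a} xs m = x∈elems⁺ (xs ∷ʳ a) (∈-++⁺ˡ (x∈elems⁻ xs m))

a∈elems-∷ʳa : ∀ (a : Fin n) (xs : List (Fin n)) → a ∈ elems (xs ∷ʳ a)
a∈elems-∷ʳa a xs = x∈elems⁺ (xs ∷ʳ a) (∈-++⁺ʳ xs (here refl))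

module _ {a : Fin n} (p : Subset n) (xs : List (Fin n)) where

  △ₗ-∷ʳ-∉ : a ∉ p → p △ₗ (xs ∷ʳ a) ≡ (p △ₗ xs) ＋ a
  △ₗ-∷ʳ-∉ a∉p = ⊆-antisym ⊆＋ ＋⊆
    where
    ⊆＋ : p △ₗ (xs ∷ʳ a) ⊆ (p △ₗ xs) ＋ a
    ⊆＋ m with x∈p△q⁻ p (elems (xs ∷ʳ a)) m
    ... | inj₁ (x∈p , x∉) = x∈p⇒x∈p＋y a _ (x∈p△q⁺ˡ p (elems xs) x∈p (λ u → x∉ (x∈elems-∷ʳ⁺ˡ xs u)))
    ... | inj₂ (x∉p , x∈) with x∈elems-∷ʳ⁻ xs x∈
    ...   | inj₁ u    = x∈p⇒x∈p＋y a _ (x∈p△q⁺ʳ p (elems xs) x∉p (x∈elems⁺ xs u))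
    ...   | inj₂ refl = y∈p＋y a _
    ＋⊆ : (p △ₗ xs) ＋ a ⊆ p △ₗ (xs ∷ʳ a)
    ＋⊆ m with x∈p＋y⁻ (p △ₗ xs) m
    ... | inj₁ refl = x∈p△q⁺ʳ p _ a∉p (a∈elems-∷ʳa a xs)
    ... | inj₂ u with x∈p△q⁻ p (elems xs) u
    ...   | inj₁ (x∈p , x∉) = x∈p△q⁺ˡ p _ x∈p
                               ([ (λ w → x∉ (x∈elems⁺ xs w)) , (λ { refl → a∉p x∈p }) ]′ ∘ x∈elems-∷ʳ⁻ xs)
    ...   | inj₂ (x∉p , x∈) = x∈p△q⁺ʳ p _ x∉p (x∈elems-∷ʳ⁺ˡ xs x∈)

  △ₗ-∷ʳ-∈ : a ∈ p → p △ₗ (xs ∷ʳ a) ≡ (p △ₗ xs) - a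
  △ₗ-∷ʳ-∈ a∈p = ⊆-antisym ⊆- -⊆
    where
    ⊆- : p △ₗ (xs ∷ʳ a) ⊆ (p △ₗ xs) - a
    ⊆- m with x∈p△q⁻ p (elems (xs ∷ʳ a)) m
    ... | inj₁ (x∈p , x∉) = x∈p∧x≢y⇒x∈p-y (x∈p△q⁺ˡ p (elems xs) x∈p (λ u → x∉ (x∈elems-∷ʳ⁺ˡ xs u)))
                                           (λ { refl → x∉ (a∈elems-∷ʳa a xs) })
    ... | inj₂ (x∉p , x∈) with x∈elems-∷ʳ⁻ xs x∈
    ...   | inj₁ u    = x∈p∧x≢y⇒x∈p-y (x∈p△q⁺ʳ p (elems xs) x∉p (x∈elems⁺ xs u)) (λ { refl → x∉p a∈p })
    ...   | inj₂ refl = ⊥-elim (x∉p a∈p)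
    -⊆ : (p △ₗ xs) - a ⊆ p △ₗ (xs ∷ʳ a)
    -⊆ m with x∈p△q⁻ p (elems xs) (x∈p-y⇒x∈p (p △ₗ xs) m)
    ... | inj₁ (x∈p , x∉) = x∈p△q⁺ˡ p _ x∈p
                             ([ (λ w → x∉ (x∈elems⁺ xs w)) , x∈p-y⇒x≢y (p △ₗ xs) m ]′ ∘ x∈elems-∷ʳ⁻ xs)
    ... | inj₂ (x∉p , x∈) = x∈p△q⁺ʳ p _ x∉p (x∈elems-∷ʳ⁺ˡ xs x∈)

  ∣△ₗ-∷ʳ-∉∣ : a ∉ p → ¬ a L.∈ xs → ∣ p △ₗ (xs ∷ʳ a) ∣ ≡ suc ∣ p △ₗ xs ∣
  ∣△ₗ-∷ʳ-∉∣ a∉p a∉xs = trans (cong ∣_∣ (△ₗ-∷ʳ-∉ a∉p)) (x∉p⇒∣p＋x∣≡1+∣p∣ (p △ₗ xs) a∉p△xs)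
    where
    a∉p△xs : a ∉ p △ₗ xs
    a∉p△xs m with x∈p△q⁻ p (elems xs) m
    ... | inj₁ (u , _) = a∉p u
    ... | inj₂ (_ , v) = a∉xs (x∈elems⁻ xs v)

  ∣△ₗ-∷ʳ-∈∣ : a ∈ p → ¬ a L.∈ xs → suc ∣ p △ₗ (xs ∷ʳ a) ∣ ≡ ∣ p △ₗ xs ∣
  ∣△ₗ-∷ʳ-∈∣ a∈p a∉xs = trans (cong (suc ∘ ∣_∣) (△ₗ-∷ʳ-∈ a∈p))
    (x∈p⇒1+∣p-x∣≡∣p∣ (p △ₗ xs) (x∈p△q⁺ˡ p (elems xs) a∈p (λ v → a∉xs (x∈elems⁻ xs v))))

△ₗ-[x] : ∀ {x : Fin n} (p : Subset n) → x ∉ p → p △ₗ [ x ] ≡ p ＋ x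
△ₗ-[x] {x = x} p x∉p = trans (△ₗ-∷ʳ-∉ p [] x∉p) (cong (_＋ x) (△ₗ-[] p))

△ₗ-∷-∷⊆ : ∀ {e y : Fin n} (p : Subset n) xs → e ∉ p → y ∈ p → p △ₗ (e ∷ y ∷ xs) ⊆ (p △ₗ xs) ＋ e - y
△ₗ-∷-∷⊆ {e = e} {y} p xs e∉p y∈p {x} m with x∈p△q⁻ p (elems (e ∷ y ∷ xs)) m
... | inj₁ (x∈p , x∉) = x∈p∧x≢y⇒x∈p-y
        (x∈p⇒x∈p＋y e _ (x∈p△q⁺ˡ p (elems xs) x∈p
          (λ u → x∉ (x∈elems⁺ (e ∷ y ∷ xs) (there (there (x∈elems⁻ xs u)))))))
        (λ { refl → x∉ (x∈elems⁺ (e ∷ y ∷ xs) (there (here refl))) })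
... | inj₂ (x∉p , x∈) with x∈elems⁻ (e ∷ y ∷ xs) x∈
...   | here refl         = x∈p∧x≢y⇒x∈p-y (y∈p＋y e _) (λ { refl → e∉p y∈p })
...   | there (here refl) = ⊥-elim (x∉p y∈p)
...   | there (there u)   = x∈p∧x≢y⇒x∈p-y (x∈p⇒x∈p＋y e _ (x∈p△q⁺ʳ p (elems xs) x∉p (x∈elems⁺ xs u)))
                              (λ { refl → x∉p y∈p })

-- Matroid exchange

module _ (M : Matroid n) where

  indep-aug* : ∀ d {W Z} → Indep M W → Indep M Z → ∣ Z ∣ ≤ d + ∣ W ∣ →
               ∃[ W′ ] (Indep M W′ × W ⊆ W′ × (∀ {x} → x ∈ W′ → x ∈ W ⊎ x ∈ Z) × ∣ Z ∣ ≤ ∣ W′ ∣)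
  indep-aug* zero    {W} iW iZ ∣Z∣≤ = W , iW , id , inj₁ , ∣Z∣≤
  indep-aug* (suc d) {W} {Z} iW iZ ∣Z∣≤ with ∣ Z ∣ ≤? ∣ W ∣
  ... | yes ∣Z∣≤∣W∣ = W , iW , id , inj₁ , ∣Z∣≤∣W∣
  ... | no  ∣Z∣≰∣W∣ with indep-aug M iW iZ (ℕ.≰⇒> ∣Z∣≰∣W∣)
  ... | e , e∈Z , e∉W , iW＋e with indep-aug* d iW＋e iZ ∣Z∣≤d+∣W＋e∣
    where
    ∣Z∣≤d+∣W＋e∣ : ∣ Z ∣ ≤ d + ∣ W ＋ e ∣
    ∣Z∣≤d+∣W＋e∣ = subst (∣ Z ∣ ≤_)
      (trans (sym (ℕ.+-suc d ∣ W ∣)) (cong (d +_) (sym (x∉p⇒∣p＋x∣≡1+∣p∣ W e∉W)))) ∣Z∣≤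
  ... | W′ , iW′ , W＋e⊆W′ , W′⊆ , ∣Z∣≤∣W′∣ =
    W′ , iW′ , W＋e⊆W′ ∘ x∈p⇒x∈p＋y e W , from-W＋e-or-Z ∘ W′⊆ , ∣Z∣≤∣W′∣
    where
    from-W＋e-or-Z : ∀ {x} → x ∈ W ＋ e ⊎ x ∈ Z → x ∈ W ⊎ x ∈ Z
    from-W＋e-or-Z (inj₁ x∈W＋e) = [ (λ { refl → inj₂ e∈Z }) , inj₁ ]′ (x∈p＋y⁻ W x∈W＋e)
    from-W＋e-or-Z (inj₂ x∈Z)    = inj₂ x∈Z

  -- Extend W to a maximal independent W′ inside X + e; it misses some g ∈ X, and has the
  -- size of X, hence equals X + e - g.
  exchange-outside : ∀ {X W} {e : Fin n} → Indep M X → e ∉ X → ¬ Indep M (X ＋ e) →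
                     W ⊆ X ＋ e → e ∈ W → Indep M W →
                     ∃[ g ] (g ∈ X × g ∉ W × Indep M (X ＋ e - g))
  exchange-outside {X} {W} {e} iX e∉X dep W⊆X＋e e∈W iW
    with indep-aug* ∣ X ∣ iW iX (ℕ.m≤m+n ∣ X ∣ ∣ W ∣)
  ... | W′ , iW′ , W⊆W′ , W′⊆ , ∣X∣≤∣W′∣
    with Fin.any? (λ g → g ∈? (X ＋ e) ×-dec ¬? (g ∈? W′))
  ... | no none = ⊥-elim (dep (indep-↓ M X＋e⊆W′ iW′))
    where
    X＋e⊆W′ : X ＋ e ⊆ W′
    X＋e⊆W′ {x} x∈ with x ∈? W′
    ... | yes x∈W′ = x∈W′
    ... | no  x∉W′ = ⊥-elim (none (x , x∈ , x∉W′))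
  ... | yes (g , g∈X＋e , g∉W′) = g , g∈X , g∉W′ ∘ W⊆W′ , indep-↓ M X＋e-g⊆W′ iW′
    where
    W′⊆X＋e : W′ ⊆ X ＋ e
    W′⊆X＋e m = [ W⊆X＋e , x∈p⇒x∈p＋y e X ]′ (W′⊆ m)
    g∈X : g ∈ X
    g∈X = [ (λ { refl → ⊥-elim (g∉W′ (W⊆W′ e∈W)) }) , id ]′ (x∈p＋y⁻ X g∈X＋e)
    X＋e-g⊆W′ : X ＋ e - g ⊆ W′
    X＋e-g⊆W′ {h} h∈ with h ∈? W′
    ... | yes h∈W′ = h∈W′
    ... | no  h∉W′ = ⊥-elim (ℕ.<-irrefl refl (ℕ.≤-<-trans ∣X∣≤∣W′∣ ∣W′∣<∣X∣))
      where
      W′⊆X＋e-g-h : W′ ⊆ (X ＋ e - g) - h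
      W′⊆X＋e-g-h m = x∈p∧x≢y⇒x∈p-y (x∈p∧x≢y⇒x∈p-y (W′⊆X＋e m) (λ { refl → g∉W′ m })) (λ { refl → h∉W′ m })
      ∣X＋e-g-h∣ : suc (suc ∣ (X ＋ e - g) - h ∣) ≤ suc ∣ X ∣
      ∣X＋e-g-h∣ = ℕ.≤-trans (s≤s (ℕ.≤-reflexive (x∈p⇒1+∣p-x∣≡∣p∣ (X ＋ e - g) h∈)))
                    (ℕ.≤-trans (ℕ.≤-reflexive (x∈p⇒1+∣p-x∣≡∣p∣ (X ＋ e) g∈X＋e)) (∣p＋x∣≤1+∣p∣ e X))
      ∣W′∣<∣X∣ : ∣ W′ ∣ < ∣ X ∣
      ∣W′∣<∣X∣ = ℕ.≤-trans (s≤s (p⊆q⇒∣p∣≤∣q∣ W′⊆X＋e-g-h)) (ℕ.≤-pred ∣X＋e-g-h∣)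

  -- If every exchange X + e - a with a ∉ K fails, the circuit of X + e lies in K + e,
  -- and it is then also the circuit of Z + e.
  circuit-transfer : ∀ {X Z K} {e f : Fin n} → Indep M X → Indep M Z → K ⊆ X → K ⊆ Z →
                     e ∉ Z → e ∉ X → ¬ Indep M (X ＋ e) → f ∈ K → Indep M (X ＋ e - f) →
                     (∀ {a} → a ∈ X → a ∉ K → ¬ Indep M (X ＋ e - a)) →
                     Indep M (Z ＋ e - f)
  circuit-transfer {X} {Z} {K} {e} {f} iX iZ K⊆X K⊆Z e∉Z e∉X depX f∈K iX＋e-f outside-K =
    exchanged-is-f (exchange-outside iZ e∉Z depZ K-f＋e⊆Z＋e (y∈p＋y e (K - f)) iK-f＋e)
    where
    depK : ¬ Indep M (K ＋ e)
    depK iK with exchange-outside iX e∉X depX (p⊆q⇒p＋x⊆q＋x K⊆X) (y∈p＋y e K) iK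
    ... | g , g∈X , g∉K＋e , iX＋e-g = outside-K g∈X (g∉K＋e ∘ x∈p⇒x∈p＋y e K) iX＋e-g
    depZ : ¬ Indep M (Z ＋ e)
    depZ = depK ∘ indep-↓ M (p⊆q⇒p＋x⊆q＋x K⊆Z)
    K-f＋e⊆Z＋e : (K - f) ＋ e ⊆ Z ＋ e
    K-f＋e⊆Z＋e = p⊆q⇒p＋x⊆q＋x (K⊆Z ∘ x∈p-y⇒x∈p K)
    K-f＋e⊆X＋e-f : (K - f) ＋ e ⊆ X ＋ e - f
    K-f＋e⊆X＋e-f m with x∈p＋y⁻ (K - f) m
    ... | inj₁ refl = x∈p∧x≢y⇒x∈p-y (y∈p＋y e X) (λ { refl → e∉X (K⊆X f∈K) })
    ... | inj₂ u    = x∈p∧x≢y⇒x∈p-y (x∈p⇒x∈p＋y e X (K⊆X (x∈p-y⇒x∈p K u))) (x∈p-y⇒x≢y K u)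
    iK-f＋e : Indep M ((K - f) ＋ e)
    iK-f＋e = indep-↓ M K-f＋e⊆X＋e-f iX＋e-f
    exchanged-is-f : ∃[ g ] (g ∈ Z × g ∉ (K - f) ＋ e × Indep M (Z ＋ e - g)) → Indep M (Z ＋ e - f)
    exchanged-is-f (g , g∈Z , g∉K-f＋e , iZ＋e-g) with g ≟ᶠ f
    ... | yes refl = iZ＋e-g
    ... | no  g≢f  = ⊥-elim (depK (indep-↓ M K＋e⊆Z＋e-g iZ＋e-g))
      where
      K＋e⊆Z＋e-g : K ＋ e ⊆ Z ＋ e - g
      K＋e⊆Z＋e-g m with x∈p＋y⁻ K m
      ... | inj₁ refl = x∈p∧x≢y⇒x∈p-y (y∈p＋y e Z) (λ { refl → e∉Z g∈Z })
      ... | inj₂ u    = x∈p∧x≢y⇒x∈p-y (x∈p⇒x∈p＋y e Z (K⊆Z u))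
                          (λ { refl → g∉K-f＋e (x∈p⇒x∈p＋y e (K - f) (x∈p∧x≢y⇒x∈p-y u g≢f)) })

-- Partition matroids

module _ {q : ℕ} (part : Fin n → Fin q) where

  Rainbow : Subset n → Set
  Rainbow X = ∀ {a b} → a ∈ X → b ∈ X → part a ≡ part b → a ≡ b

  Rainbow-⊆ : ∀ {X Y} → X ⊆ Y → Rainbow Y → Rainbow X
  Rainbow-⊆ X⊆Y rY a∈X b∈X = rY (X⊆Y a∈X) (X⊆Y b∈X)

  x∈Class⁺ : ∀ {x i} → part x ≡ i → x ∈ Class part i
  x∈Class⁺ {x} {i} px≡i = lookup⇒[]= x _
    (trans (lookup∘tabulate _ x) (dec-true (part x ≟ᶠ i) px≡i))

  x∈Class⁻ : ∀ {x i} → x ∈ Class part i → part x ≡ i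
  x∈Class⁻ {x} {i} m = does⇒ (part x ≟ᶠ i)
    (trans (sym (lookup∘tabulate (λ e → does (part e ≟ᶠ i)) x)) ([]=⇒lookup m))
    where
    does⇒ : ∀ {A : Set} (a? : Dec A) → does a? ≡ true → A
    does⇒ (yes a) _ = a

  module _ (M : Matroid n) (indep⇔ : ∀ X → Indep M X ⇔ (∀ i → ∣ X ∩ Class part i ∣ ≤ 1)) where

    indep⇒Rainbow : ∀ {X} → Indep M X → Rainbow X
    indep⇒Rainbow {X} iX {a} {b} a∈X b∈X pa≡pb with a ≟ᶠ b
    ... | yes a≡b = a≡b
    ... | no  a≢b = ⊥-elim (ℕ.<-irrefl refl (ℕ.≤-trans 2≤∣X∩Class∣ (Equivalence.to (indep⇔ X) iX (part b))))
      where
      pair⊆ : ⁅ b ⁆ ＋ a ⊆ X ∩ Class part (part b)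
      pair⊆ m with x∈p＋y⁻ ⁅ b ⁆ m
      ... | inj₁ refl = x∈p∩q⁺ (a∈X , x∈Class⁺ pa≡pb)
      ... | inj₂ u with x∈⁅y⁆⇒x≡y b u
      ...   | refl = x∈p∩q⁺ (b∈X , x∈Class⁺ refl)
      2≤∣X∩Class∣ : 2 ≤ ∣ X ∩ Class part (part b) ∣
      2≤∣X∩Class∣ = ℕ.≤-trans
        (ℕ.≤-reflexive (trans (cong suc (sym (∣⁅x⁆∣≡1 b)))
                              (sym (x∉p⇒∣p＋x∣≡1+∣p∣ ⁅ b ⁆ (a≢b ∘ x∈⁅y⁆⇒x≡y b)))))
        (p⊆q⇒∣p∣≤∣q∣ pair⊆)

    Rainbow⇒indep : ∀ {X} → Rainbow X → Indep M X
    Rainbow⇒indep {X} rX = Equivalence.from (indep⇔ X) ∣X∩Class∣≤1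
      where
      ∣X∩Class∣≤1 : ∀ i → ∣ X ∩ Class part i ∣ ≤ 1
      ∣X∩Class∣≤1 i with nonempty? (X ∩ Class part i)
      ... | no  empty = ℕ.≤-trans (ℕ.≤-reflexive
              (trans (cong ∣_∣ (Empty-unique empty)) (∣⊥∣≡0 n))) z≤n
      ... | yes (a , a∈) = ℕ.≤-trans (p⊆q⇒∣p∣≤∣q∣ ⊆⁅a⁆) (ℕ.≤-reflexive (∣⁅x⁆∣≡1 a))
        where
        ⊆⁅a⁆ : X ∩ Class part i ⊆ ⁅ a ⁆
        ⊆⁅a⁆ m with x∈p∩q⁻ X (Class part i) m | x∈p∩q⁻ X (Class part i) a∈
        ... | x∈X , x∈C | a∈X , a∈C with rX x∈X a∈X (trans (x∈Class⁻ x∈C) (sym (x∈Class⁻ a∈C)))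
        ...   | refl = x∈⁅x⁆ a

module _ {A : Set} where

  length-∷ʳ : ∀ (xs : List A) x → length (xs ∷ʳ x) ≡ suc (length xs)
  length-∷ʳ []       x = refl
  length-∷ʳ (_ ∷ xs) x = cong suc (length-∷ʳ xs x)

  length-∷ʳ₂ : ∀ (xs : List A) x y → length ((xs ∷ʳ x) ∷ʳ y) ≡ 2 + length xs
  length-∷ʳ₂ xs x y = trans (length-∷ʳ (xs ∷ʳ x) y) (cong suc (length-∷ʳ xs x))

  last-∷ʳ : ∀ (xs : List A) x → last (xs ∷ʳ x) ≡ just x
  last-∷ʳ []           x = refl
  last-∷ʳ (_ ∷ [])     x = refl
  last-∷ʳ (_ ∷ y ∷ xs) x = last-∷ʳ (y ∷ xs) x

  Linked-∷ʳ : ∀ {R : A → A → Set} {u v} (xs : List A) →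
              Linked R xs → last xs ≡ just u → R u v → Linked R (xs ∷ʳ v)
  Linked-∷ʳ (_ ∷ [])     [-]      refl r = r ∷ [-]
  Linked-∷ʳ (_ ∷ y ∷ xs) (r′ ∷ l) eq   r = r′ ∷ Linked-∷ʳ (y ∷ xs) l eq r

  ∉-∷ʳ : ∀ {y x} {xs : List A} → ¬ y L.∈ xs → y ≢ x → ¬ y L.∈ (xs ∷ʳ x)
  ∉-∷ʳ {xs = xs} y∉xs y≢x y∈ with ∈-++⁻ xs y∈
  ... | inj₁ y∈xs        = y∉xs y∈xs
  ... | inj₂ (here y≡x) = y≢x y≡x

  Unique-∷ʳ : ∀ {v} (xs : List A) → Unique xs → ¬ v L.∈ xs → Unique (xs ∷ʳ v)
  Unique-∷ʳ []       []      _    = [] ∷ []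
  Unique-∷ʳ (x ∷ xs) (x∉ ∷ u) v∉xs =
    All.++⁺ x∉ ((λ { refl → v∉xs (here refl) }) ∷ []) ∷ Unique-∷ʳ xs u (v∉xs ∘ there)

_∈ₗ?_ : (x : Fin n) (xs : List (Fin n)) → Dec (x L.∈ xs)
_∈ₗ?_ = Data.List.Membership.DecPropositional._∈?_ _≟ᶠ_

data Even : ℕ → Set
data Odd  : ℕ → Set

data Even where
  zero : Even 0
  suc  : ∀ {m} → Odd m → Even (suc m)

data Odd where
  suc : ∀ {m} → Even m → Odd (suc m)

¬Even∧Odd : ∀ {m} → Even m → ¬ Odd m
¬Even∧Odd (suc o) (suc e) = ¬Even∧Odd e o

Even-2* : ∀ j → Even (2 * j)
Even-2* zero    = zero
Even-2* (suc j) = subst Even (cong suc (sym (ℕ.+-suc j (j + 0)))) (suc (suc (Even-2* j)))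

Even-m≤n≤1+m⇒m≡n : ∀ {m N} → m ≤ N → N ≤ suc m → Even m → Even N → m ≡ N
Even-m≤n≤1+m⇒m≡n m≤N N≤1+m em eN with ℕ.m≤n⇒m<n∨m≡n m≤N
... | inj₂ m≡N = m≡N
... | inj₁ m<N with ℕ.≤-antisym m<N N≤1+m | eN
...   | refl | suc o = ⊥-elim (¬Even∧Odd em o)

Even-2ℓ<m⇒2+2ℓ≤m : ∀ ℓ {m} → Even m → 2 * ℓ < m → 2 + 2 * ℓ ≤ m
Even-2ℓ<m⇒2+2ℓ≤m ℓ em 2ℓ<m with ℕ.m≤n⇒m<n∨m≡n 2ℓ<m
... | inj₁ 1+2ℓ<m = 1+2ℓ<m
... | inj₂ refl   = ⊥-elim (¬Even∧Odd em (suc (Even-2* ℓ)))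

-- Paths in the exchange graph D′[I]

module ExchangeGraph (M₁ M₂ : Matroid n) {q} (part : Fin n → Fin q)
  (indep₁⇔ : ∀ X → Indep M₁ X ⇔ (∀ i → ∣ X ∩ Class part i ∣ ≤ 1))
  (I : Subset n) (s : Fin n) (s∉I : s ∉ I) (iI₁ : Indep M₁ I) (iI₂ : Indep M₂ I) where

  open Setup M₁ M₂ I s

  rainbow : ∀ {X} → Indep M₁ X → Rainbow part X
  rainbow = indep⇒Rainbow part M₁ indep₁⇔

  unrainbow : ∀ {X} → Rainbow part X → Indep M₁ X
  unrainbow = Rainbow⇒indep part M₁ indep₁⇔

  arc-from-I : ∀ {u v} → D′ u v → u ∈ I → v ∉ I × part v ≡ part u
  arc-from-I (inj₂ ((u∉I , _) , _)) u∈I = ⊥-elim (u∉I u∈I)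
  arc-from-I {u} {v} (inj₁ ((v∉I , u∈I , iI＋v-u) , v∉S)) _ = v∉I , same-class
    where
    same-class : part v ≡ part u
    same-class with Fin.any? (λ w → (w ∈? I) ×-dec (part w ≟ᶠ part v))
    ... | no none = ⊥-elim (v∉S (v∉I , unrainbow rI＋v))
      where
      rI＋v : Rainbow part (I ＋ v)
      rI＋v a∈ b∈ pa≡pb with x∈p＋y⁻ I a∈ | x∈p＋y⁻ I b∈
      ... | inj₁ refl | inj₁ refl = refl
      ... | inj₁ refl | inj₂ b∈I  = ⊥-elim (none (_ , b∈I , sym pa≡pb))
      ... | inj₂ a∈I  | inj₁ refl = ⊥-elim (none (_ , a∈I , pa≡pb))
      ... | inj₂ a∈I  | inj₂ b∈I  = rainbow iI₁ a∈I b∈I pa≡pb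
    ... | yes (w , w∈I , pw≡pv) with w ≟ᶠ u
    ...   | yes refl = sym pw≡pv
    ...   | no  w≢u  = ⊥-elim (v∉I (subst (_∈ I) w≡v w∈I))
      where
      w≡v : w ≡ v
      w≡v = rainbow iI＋v-u (x∈p∧x≢y⇒x∈p-y (x∈p⇒x∈p＋y v I w∈I) w≢u)
              (x∈p∧x≢y⇒x∈p-y (y∈p＋y v I) (λ { refl → v∉I u∈I })) pw≡pv

  arc-into-I : ∀ {u v} → D′ u v → u ∉ I → v ∈ I × Indep M₂ (I ＋ u - v) × ¬ T_I u
  arc-into-I (inj₁ ((_ , u∈I , _) , _))   u∉I = ⊥-elim (u∉I u∈I)
  arc-into-I (inj₂ ((_ , v∈I , iI＋u-v) , u∉T)) _ = v∈I , iI＋u-v , u∉T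

  D′-from-I : ∀ {u v} → u ∈ I → v ∉ I → part v ≡ part u → D′ u v
  D′-from-I {u} {v} u∈I v∉I pv≡pu =
    inj₁ ((v∉I , u∈I , unrainbow rI＋v-u) ,
          λ { (_ , iI＋v) → v∉I (subst (_∈ I) (sym (rainbow iI＋v (y∈p＋y v I) (x∈p⇒x∈p＋y v I u∈I) pv≡pu)) u∈I) })
    where
    rI＋v-u : Rainbow part (I ＋ v - u)
    rI＋v-u a∈ b∈ pa≡pb with x∈p＋y⁻ I (x∈p-y⇒x∈p (I ＋ v) a∈) | x∈p＋y⁻ I (x∈p-y⇒x∈p (I ＋ v) b∈)
    ... | inj₁ refl | inj₁ refl = refl
    ... | inj₁ refl | inj₂ b∈I  = ⊥-elim (x∈p-y⇒x≢y (I ＋ v) b∈ (rainbow iI₁ b∈I u∈I (trans (sym pa≡pb) pv≡pu)))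
    ... | inj₂ a∈I  | inj₁ refl = ⊥-elim (x∈p-y⇒x≢y (I ＋ v) a∈ (rainbow iI₁ a∈I u∈I (trans pa≡pb pv≡pu)))
    ... | inj₂ a∈I  | inj₂ b∈I  = rainbow iI₁ a∈I b∈I pa≡pb

  D′-into-I : ∀ {u v} → u ∉ I → v ∈ I → Indep M₂ (I ＋ u - v) → ¬ T_I u → D′ u v
  D′-into-I u∉I v∈I iI＋u-v u∉T = inj₂ ((u∉I , v∈I , iI＋u-v) , u∉T)

  same-class⇒¬CI : ∀ {u v} → u ∈ I → v ∉ I → part u ≡ part v → ¬ CI (⁅ u ⁆ ∪ ⁅ v ⁆)
  same-class⇒¬CI {u} {v} u∈I v∉I pu≡pv (i₁ , _) =
    v∉I (subst (_∈ I) (rainbow i₁ (y∈p＋y u ⁅ v ⁆) (x∈p⇒x∈p＋y u ⁅ v ⁆ (x∈⁅x⁆ v)) pu≡pv) u∈I)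

  ¬CI⇒same-class : ∀ {u v Y} → ¬ CI (⁅ u ⁆ ∪ ⁅ v ⁆) → u ∈ Y → v ∈ Y → Indep M₂ Y → part u ≡ part v
  ¬CI⇒same-class {u} {v} {Y} ¬ci u∈Y v∈Y iY with part u ≟ᶠ part v
  ... | yes pu≡pv = pu≡pv
  ... | no  pu≢pv = ⊥-elim (¬ci (unrainbow rainbow-pair , indep-↓ M₂ pair⊆Y iY))
    where
    pair⁻ : ∀ {a} → a ∈ ⁅ v ⁆ ＋ u → a ≡ u ⊎ a ≡ v
    pair⁻ m = [ inj₁ , inj₂ ∘ x∈⁅y⁆⇒x≡y v ]′ (x∈p＋y⁻ ⁅ v ⁆ m)
    pair⊆Y : ⁅ v ⁆ ＋ u ⊆ Y
    pair⊆Y m = [ (λ { refl → u∈Y }) , (λ { refl → v∈Y }) ]′ (pair⁻ m)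
    rainbow-pair : Rainbow part (⁅ v ⁆ ＋ u)
    rainbow-pair a∈ b∈ pa≡pb with pair⁻ a∈ | pair⁻ b∈
    ... | inj₁ refl | inj₁ refl = refl
    ... | inj₂ refl | inj₂ refl = refl
    ... | inj₁ refl | inj₂ refl = ⊥-elim (pu≢pv pa≡pb)
    ... | inj₂ refl | inj₁ refl = ⊥-elim (pu≢pv (sym pa≡pb))

  data Path : List (Fin n) → Fin n → Set where
    start : Path [ s ] s
    snoc  : ∀ {Q u v} → Path Q u → D′ u v → ¬ v L.∈ Q → Path (Q ∷ʳ v) v

  data Walk : Fin n → List (Fin n) → Fin n → Set where
    done : ∀ {u} → Walk u [] u
    step : ∀ {u v L w} → D′ u v → Walk v L w → Walk u (v ∷ L) w

  Path-parity : ∀ {Q v} → Path Q v → (v ∈ I → Even (length Q)) × (v ∉ I → Odd (length Q))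
  Path-parity start = (λ s∈I → ⊥-elim (s∉I s∈I)) , (λ _ → suc zero)
  Path-parity (snoc {Q} {u} {v} p d _) with u ∈? I
  ... | yes u∈I = (λ v∈I → ⊥-elim (proj₁ (arc-from-I d u∈I) v∈I)) ,
                  (λ _ → subst Odd (sym (length-∷ʳ Q v)) (suc (proj₁ (Path-parity p) u∈I)))
  ... | no  u∉I = (λ _ → subst Even (sym (length-∷ʳ Q v)) (suc (proj₂ (Path-parity p) u∉I))) ,
                  (λ v∉I → ⊥-elim (v∉I (proj₁ (arc-into-I d u∉I))))

  Path-even : ∀ {Q v} → Path Q v → v ∈ I → Even (length Q)
  Path-even p = proj₁ (Path-parity p)

  Path-odd : ∀ {Q v} → Path Q v → v ∉ I → Odd (length Q)
  Path-odd p = proj₂ (Path-parity p)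

  Path-length≥1 : ∀ {Q v} → Path Q v → 1 ≤ length Q
  Path-length≥1 start                  = s≤s z≤n
  Path-length≥1 (snoc {Q} {v = v} _ _ _) = subst (1 ≤_) (sym (length-∷ʳ Q v)) (s≤s z≤n)

  Path-last∈ : ∀ {Q v} → Path Q v → v L.∈ Q
  Path-last∈ start          = here refl
  Path-last∈ (snoc {Q} _ _ _) = ∈-++⁺ʳ Q (here refl)

  Path-prefix : ∀ {Q u v} → Path Q u → v L.∈ Q → v ≡ u ⊎ ∃[ Qv ] (Path Qv v × length Qv < length Q)
  Path-prefix start (here refl) = inj₁ refl
  Path-prefix (snoc {Q} {v = w} p _ _) v∈ with ∈-++⁻ Q v∈
  ... | inj₂ (here refl) = inj₁ refl
  ... | inj₁ v∈Q with Path-prefix p v∈Q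
  ...   | inj₁ refl            = inj₂ (Q , p , subst (length Q <_) (sym (length-∷ʳ Q w)) ℕ.≤-refl)
  ...   | inj₂ (Qv , pv , lt) = inj₂ (Qv , pv , subst (length Qv <_) (sym (length-∷ʳ Q w)) (ℕ.m≤n⇒m≤1+n lt))

  Path-prefix≤ : ∀ {Q u v} → Path Q u → v L.∈ Q → ∃[ Qv ] (Path Qv v × length Qv ≤ length Q)
  Path-prefix≤ p v∈ with Path-prefix p v∈
  ... | inj₁ refl           = _ , p , ℕ.≤-refl
  ... | inj₂ (Qv , pv , lt) = Qv , pv , ℕ.<⇒≤ lt

  shortcut : ∀ {R u L w} → Path R u → Walk u L w → ∃[ G ] (Path G w × length G ≤ length R + length L)
  shortcut {R} p done = R , p , ℕ.m≤m+n (length R) 0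
  shortcut {R} {L = v ∷ L} p (step d wk) with v ∈ₗ? R
  ... | yes v∈R with Path-prefix≤ p v∈R
  ...   | Rv , pv , Rv≤R with shortcut pv wk
  ...     | G , pg , G≤ = G , pg , (begin
            length G              ≤⟨ G≤ ⟩
            length Rv + length L  ≤⟨ ℕ.+-mono-≤ Rv≤R (ℕ.n≤1+n (length L)) ⟩
            length R + suc (length L) ∎)
  shortcut {R} {L = v ∷ L} p (step d wk) | no v∉R with shortcut (snoc p d v∉R) wk
  ... | G , pg , G≤ = G , pg , ℕ.≤-trans G≤
          (ℕ.≤-reflexive (trans (cong (_+ length L) (length-∷ʳ R v)) (sym (ℕ.+-suc (length R) (length L)))))

  Walk-∷ʳ : ∀ {u L w v} → Walk u L w → D′ w v → Walk u (L ∷ʳ v) v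
  Walk-∷ʳ done         d = step d done
  Walk-∷ʳ (step d′ wk) d = step d′ (Walk-∷ʳ wk d)

  Walk-suffix : ∀ {u L w a} → Walk u L w → a L.∈ L → ∃[ La ] (Walk a La w × length La < length L)
  Walk-suffix (step _ wk) (here refl) = _ , wk , ℕ.≤-refl
  Walk-suffix (step _ wk) (there a∈) with Walk-suffix wk a∈
  ... | La , wa , lt = La , wa , ℕ.m≤n⇒m≤1+n lt

  Path-split : ∀ {G t} → Path G t → ∀ m → 1 ≤ m → m ≤ length G →
               ∃[ R ] ∃[ u ] ∃[ L ] (Path R u × length R ≡ m × Walk u L t × length R + length L ≡ length G)
  Path-split start (suc zero)    _ _             = _ , _ , [] , start , refl , done , refl
  Path-split start (suc (suc _)) _ (s≤s ())
  Path-split (snoc {Q} {v = v} p d v∉Q) m 1≤m m≤ with m ≤? length Q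
  ... | yes m≤Q with Path-split p m 1≤m m≤Q
  ...   | R , w , L , pr , R≡m , wk , R+L≡Q = R , w , L ∷ʳ v , pr , R≡m , Walk-∷ʳ wk d , (begin-equality
          length R + length (L ∷ʳ v) ≡⟨ cong (length R +_) (length-∷ʳ L v) ⟩
          length R + suc (length L)  ≡⟨ ℕ.+-suc (length R) (length L) ⟩
          suc (length R + length L)  ≡⟨ cong suc R+L≡Q ⟩
          suc (length Q)             ≡⟨ length-∷ʳ Q v ⟨
          length (Q ∷ʳ v)            ∎)
  Path-split (snoc {Q} {v = v} p d v∉Q) m 1≤m m≤ | no m≰Q =
    Q ∷ʳ v , v , [] , snoc p d v∉Q ,
    ℕ.≤-antisym (subst (_≤ m) (sym (length-∷ʳ Q v)) (ℕ.≰⇒> m≰Q)) m≤ , done , ℕ.+-identityʳ _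

  Linked⇒Walk : ∀ {u w} L → Linked D′ (u ∷ L) → last (u ∷ L) ≡ just w → Walk u L w
  Linked⇒Walk []      [-]     refl = done
  Linked⇒Walk (v ∷ L) (d ∷ l) eq   = step d (Linked⇒Walk L l eq)

  STPath⇒Path : ∀ {P} → STPath P → ∃[ G ] ∃[ t ] (Path G t × T_I t × length G ≤ length P)
  STPath⇒Path ((rest , refl) , _ , l , t , lst , t∈T) with shortcut start (Linked⇒Walk rest l lst)
  ... | G , pg , G≤ = G , t , pg , t∈T , G≤

  Path⇒STPath : ∀ {Q t} → Path Q t → T_I t → STPath Q
  Path⇒STPath {t = t} p t∈T = let (hd , u , l , lst) = parts p in hd , u , l , t , lst , t∈T
    where
    parts : ∀ {Q v} → Path Q v → (∃[ rest ] Q ≡ s ∷ rest) × Unique Q × Linked D′ Q × last Q ≡ just v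
    parts start = ([] , refl) , ([] ∷ []) , [-] , refl
    parts (snoc {Q} {v = v} p d v∉Q) with parts p
    ... | (rest , refl) , u , l , lst = (rest ∷ʳ v , refl) , Unique-∷ʳ Q u v∉Q , Linked-∷ʳ Q l lst d , last-∷ʳ Q v

  tail∉I : ∀ {u v} → D′ u v → v ∈ I → u ∉ I
  tail∉I d v∈I u∈I = proj₁ (arc-from-I d u∈I) v∈I

  tail∈I : ∀ {u v} → D′ u v → v ∉ I → u ∈ I
  tail∈I {u} d v∉I with u ∈? I
  ... | yes u∈I = u∈I
  ... | no  u∉I = ⊥-elim (v∉I (proj₁ (arc-into-I d u∉I)))

  Dist≥ : (Fin n → Set) → ℕ → Set
  Dist≥ Tgt m = ∀ {G w} → Path G w → Tgt w → m ≤ length G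

  -- If I + e - a were M₂-independent for some a ∈ I on the suffix, the arc (e, a) would
  -- shorten the path; so the exchange (e, y) carries over from I to I △ Sfx.
  indep₂-prepend-arc : ∀ {R₁ e y Sfx w} {Tgt : Fin n → Set} → Path R₁ e → e ∉ I → D′ e y → y ∈ I →
                       Walk y Sfx w → Tgt w → (∀ {z} → z L.∈ Sfx → ¬ z L.∈ (R₁ ∷ʳ y)) →
                       Indep M₂ (I △ₗ Sfx) → Dist≥ Tgt (suc (length R₁) + length Sfx) →
                       Indep M₂ (I △ₗ (e ∷ y ∷ Sfx))
  indep₂-prepend-arc {R₁} {e} {y} {Sfx} p e∉I d y∈I wk w∈T disj iZ dist =
    indep-↓ M₂ (△ₗ-∷-∷⊆ I Sfx e∉I y∈I)
      (circuit-transfer M₂ {I} {Z} {K} {e} {y} iI₂ iZ (p─q⊆p I (elems Sfx)) K⊆Z e∉Z e∉I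
                          ¬iI＋e y∈K iI＋e-y exchange-on-suffix-fails)
    where
    Z = I △ₗ Sfx
    K = I ─ elems Sfx
    e∉Sfx : ¬ e L.∈ Sfx
    e∉Sfx m = disj m (∈-++⁺ˡ (Path-last∈ p))
    y∉Sfx : ¬ y L.∈ Sfx
    y∉Sfx m = disj m (∈-++⁺ʳ R₁ (here refl))
    K⊆Z : K ⊆ Z
    K⊆Z m = x∈p△q⁺ˡ I (elems Sfx) (p─q⊆p I (elems Sfx) m) (x∈p─q⇒x∉q I (elems Sfx) m)
    e∉Z : e ∉ Z
    e∉Z m with x∈p△q⁻ I (elems Sfx) m
    ... | inj₁ (e∈I , _) = e∉I e∈I
    ... | inj₂ (_ , e∈)  = e∉Sfx (x∈elems⁻ Sfx e∈)
    iI＋e-y : Indep M₂ (I ＋ e - y)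
    iI＋e-y = proj₁ (proj₂ (arc-into-I d e∉I))
    e∉T : ¬ T_I e
    e∉T = proj₂ (proj₂ (arc-into-I d e∉I))
    ¬iI＋e : ¬ Indep M₂ (I ＋ e)
    ¬iI＋e iI＋e = e∉T (e∉I , iI＋e)
    y∈K : y ∈ K
    y∈K = x∈p∧x∉q⇒x∈p─q y∈I (y∉Sfx ∘ x∈elems⁻ Sfx)
    exchange-on-suffix-fails : ∀ {a} → a ∈ I → a ∉ K → ¬ Indep M₂ (I ＋ e - a)
    exchange-on-suffix-fails {a} a∈I a∉K iI＋e-a with a ∈? elems Sfx
    ... | no  a∉Sfx = a∉K (x∈p∧x∉q⇒x∈p─q a∈I a∉Sfx)
    ... | yes a∈Sfx with Walk-suffix wk (x∈elems⁻ Sfx a∈Sfx)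
    ...   | La , wa , La<Sfx with shortcut p (step (D′-into-I e∉I a∈I iI＋e-a e∉T) wa)
    ...     | G , pg , G≤ = ℕ.<-irrefl refl (begin-strict
              suc (length R₁) + length Sfx ≤⟨ dist pg w∈T ⟩
              length G                     ≤⟨ G≤ ⟩
              length R₁ + suc (length La)  ≤⟨ ℕ.+-monoʳ-≤ (length R₁) La<Sfx ⟩
              length R₁ + length Sfx       <⟨ ℕ.n<1+n _ ⟩
              suc (length R₁) + length Sfx ∎)

  -- Peel the path into arc pairs from its end, applying indep₂-prepend-arc to each.
  indep₂-along-shortest : ∀ {R y Sfx w} {Tgt : Fin n → Set} → Path R y → y ∈ I → Walk y Sfx w → Tgt w →
                          (∀ {z} → z L.∈ Sfx → ¬ z L.∈ R) → Indep M₂ (I △ₗ Sfx) →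
                          Dist≥ Tgt (length R + length Sfx) → Indep M₂ (I △ₗ (R ++ Sfx))
  indep₂-along-shortest start y∈I = ⊥-elim (s∉I y∈I)
  indep₂-along-shortest (snoc start d y∉) y∈I wk w∈T disj iZ dist =
    indep₂-prepend-arc start s∉I d y∈I wk w∈T disj iZ dist
  indep₂-along-shortest {y = y} {Sfx} {Tgt = Tgt} (snoc (snoc {R₂} {_} {e} p₂ d₂ e∉R₂) d₁ y∉)
                        y∈I wk w∈T disj iZ dist =
    subst (λ X → Indep M₂ (I △ₗ X)) (sym ++-assoc₃)
      (indep₂-along-shortest p₂ (tail∈I d₂ e∉I) (step d₂ (step d₁ wk)) w∈T disj′
        (indep₂-prepend-arc (snoc p₂ d₂ e∉R₂) e∉I d₁ y∈I wk w∈T disj iZ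
          (subst (λ m → Dist≥ Tgt (m + length Sfx)) (length-∷ʳ (R₂ ∷ʳ e) y) dist))
        (subst (Dist≥ Tgt) length≡ dist))
    where
    e∉I = tail∉I d₁ y∈I
    ++-assoc₃ : ((R₂ ∷ʳ e) ∷ʳ y) ++ Sfx ≡ R₂ ++ (e ∷ y ∷ Sfx)
    ++-assoc₃ = trans (List.++-assoc (R₂ ∷ʳ e) [ y ] Sfx) (List.++-assoc R₂ [ e ] (y ∷ Sfx))
    disj′ : ∀ {z} → z L.∈ (e ∷ y ∷ Sfx) → ¬ z L.∈ R₂
    disj′ (here refl)         = e∉R₂
    disj′ (there (here refl)) = y∉ ∘ ∈-++⁺ˡ
    disj′ (there (there z∈)) = disj z∈ ∘ ∈-++⁺ˡ ∘ ∈-++⁺ˡ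
    length≡ : length ((R₂ ∷ʳ e) ∷ʳ y) + length Sfx ≡ length R₂ + length (e ∷ y ∷ Sfx)
    length≡ = begin-equality
      length ((R₂ ∷ʳ e) ∷ʳ y) + length Sfx ≡⟨ cong (_+ length Sfx) (length-∷ʳ₂ R₂ e y) ⟩
      suc (suc (length R₂)) + length Sfx   ≡⟨ cong suc (ℕ.+-suc (length R₂) (length Sfx)) ⟨
      suc (length R₂ + suc (length Sfx))   ≡⟨ ℕ.+-suc (length R₂) (suc (length Sfx)) ⟨
      length R₂ + length (e ∷ y ∷ Sfx)     ∎

  Matched : List (Fin n) → Fin n → Set
  Matched Q u = ∃[ w ] (w L.∈ Q × w ∈ I × part w ≡ part u)

  record ClassInvariant (Q : List (Fin n)) (v : Fin n) : Set where
    field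
      rainbow-△ : Rainbow part (I △ₗ Q)
      vacated   : v ∈ I → ∀ {u} → u ∈ I △ₗ Q → part u ≢ part v
      matched   : ∀ {u} → u L.∈ Q → u ∉ I → u ≢ s → Matched Q u

  matched-∷ʳ : ∀ {Q v} → (∀ {u} → u L.∈ Q → u ∉ I → u ≢ s → Matched Q u) → (v ∉ I → Matched Q v) →
               ∀ {u} → u L.∈ (Q ∷ʳ v) → u ∉ I → u ≢ s → Matched (Q ∷ʳ v) u
  matched-∷ʳ {Q} matched matched-v u∈ u∉I u≢s with ∈-++⁻ Q u∈
  ... | inj₂ (here refl) = let (w , w∈Q , rest) = matched-v u∉I in w , ∈-++⁺ˡ w∈Q , rest
  ... | inj₁ u∈Q         = let (w , w∈Q , rest) = matched u∈Q u∉I u≢s in w , ∈-++⁺ˡ w∈Q , rest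

  ClassInvariant-start : S_I s → ClassInvariant [ s ] s
  ClassInvariant-start s∈S = record
    { rainbow-△ = subst (Rainbow part) (sym (△ₗ-[x] I s∉I)) (rainbow (proj₂ s∈S))
    ; vacated   = λ s∈I → ⊥-elim (s∉I s∈I)
    ; matched   = λ { (here refl) _ u≢s → ⊥-elim (u≢s refl) }
    }

  -- u ∈ I has left I △ Q, and v takes over its class.
  ClassInvariant-snoc-∉ : ∀ {Q u v} → Path Q u → D′ u v → u ∈ I → ClassInvariant Q u →
                          ClassInvariant (Q ∷ʳ v) v
  ClassInvariant-snoc-∉ {Q} {u} {v} p d u∈I inv = record
    { rainbow-△ = subst (Rainbow part) (sym (△ₗ-∷ʳ-∉ I Q v∉I)) rainbow-＋v
    ; vacated   = λ v∈I → ⊥-elim (v∉I v∈I)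
    ; matched   = matched-∷ʳ matched (λ _ → u , Path-last∈ p , u∈I , sym pv≡pu)
    }
    where
    open ClassInvariant inv
    v∉I = proj₁ (arc-from-I d u∈I)
    pv≡pu = proj₂ (arc-from-I d u∈I)
    rainbow-＋v : Rainbow part ((I △ₗ Q) ＋ v)
    rainbow-＋v a∈ b∈ pa≡pb with x∈p＋y⁻ (I △ₗ Q) a∈ | x∈p＋y⁻ (I △ₗ Q) b∈
    ... | inj₁ refl | inj₁ refl = refl
    ... | inj₁ refl | inj₂ b∈′  = ⊥-elim (vacated u∈I b∈′ (trans (sym pa≡pb) pv≡pu))
    ... | inj₂ a∈′  | inj₁ refl = ⊥-elim (vacated u∈I a∈′ (trans pa≡pb pv≡pu))
    ... | inj₂ a∈′  | inj₂ b∈′  = rainbow-△ a∈′ b∈′ pa≡pb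

  -- The class of a removed v ∈ I could only be refilled by s (excluded by s ∈ S_I) or by an
  -- element matched to v, which would put v on Q.
  ClassInvariant-snoc-∈ : S_I s → ∀ {Q u v} → D′ u v → u ∉ I → ¬ v L.∈ Q → ClassInvariant Q u →
                          ClassInvariant (Q ∷ʳ v) v
  ClassInvariant-snoc-∈ s∈S {Q} {u} {v} d u∉I v∉Q inv = record
    { rainbow-△ = subst (Rainbow part) (sym (△ₗ-∷ʳ-∈ I Q v∈I)) (Rainbow-⊆ part (x∈p-y⇒x∈p (I △ₗ Q)) rainbow-△)
    ; vacated   = λ _ → vacated′
    ; matched   = matched-∷ʳ matched (λ v∉I → ⊥-elim (v∉I v∈I))
    }
    where
    open ClassInvariant inv
    v∈I = proj₁ (arc-into-I d u∉I)
    vacated′ : ∀ {w} → w ∈ I △ₗ (Q ∷ʳ v) → part w ≢ part v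
    vacated′ {w} = vacated-∖v ∘ subst (w ∈_) (△ₗ-∷ʳ-∈ I Q v∈I)
      where
      vacated-∖v : w ∈ (I △ₗ Q) - v → part w ≢ part v
      vacated-∖v w∈ pw≡pv with x∈p△q⁻ I (elems Q) (x∈p-y⇒x∈p (I △ₗ Q) w∈)
      ... | inj₁ (w∈I , _) = x∈p-y⇒x≢y (I △ₗ Q) w∈ (rainbow iI₁ w∈I v∈I pw≡pv)
      ... | inj₂ (w∉I , w∈Q) with w ≟ᶠ s
      ...   | yes refl = s∉I (subst (_∈ I) (sym (rainbow (proj₂ s∈S) (y∈p＋y s I) (x∈p⇒x∈p＋y s I v∈I) pw≡pv)) v∈I)
      ...   | no  w≢s with matched (x∈elems⁻ Q w∈Q) w∉I w≢s
      ...     | z , z∈Q , z∈I , pz≡pw with rainbow iI₁ z∈I v∈I (trans pz≡pw pw≡pv)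
      ...       | refl = v∉Q z∈Q

  classInvariant : S_I s → ∀ {Q v} → Path Q v → ClassInvariant Q v
  classInvariant s∈S start = ClassInvariant-start s∈S
  classInvariant s∈S (snoc {u = u} p d v∉Q) with u ∈? I
  ... | yes u∈I = ClassInvariant-snoc-∉ p d u∈I (classInvariant s∈S p)
  ... | no  u∉I = ClassInvariant-snoc-∈ s∈S d u∉I v∉Q (classInvariant s∈S p)

  indep₁-along-path : S_I s → ∀ {Q v} → Path Q v → Indep M₁ (I △ₗ Q)
  indep₁-along-path s∈S p = unrainbow (ClassInvariant.rainbow-△ (classInvariant s∈S p))

-- Correctness of the procedure

module Updates (M₁ M₂ : Matroid n) (I : Subset n) (s : Fin n) where

  open Setup M₁ M₂ I s

  UpdAt-just : ∀ {ℓ P y m Q} → UpdAt ℓ P y m → P y ≡ just Q → m ≡ just Q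
  UpdAt-just (keep _)           Py≡ = Py≡
  UpdAt-just (set _ Py≡ _ _ _ _) Py≡′ with trans (sym Py≡′) Py≡
  ... | ()
  UpdAt-just (stay _ Py≡ _)      Py≡′ with trans (sym Py≡′) Py≡
  ... | ()

  UpdAt-nothing : ∀ {ℓ P y m} → UpdAt ℓ P y m → m ≡ nothing → P y ≡ nothing
  UpdAt-nothing (keep _)          m≡ = m≡
  UpdAt-nothing (stay _ Py≡ _)    _  = Py≡

module Correctness (M₁ M₂ : Matroid n) {q} (part : Fin n → Fin q)
  (indep₁⇔ : ∀ X → Indep M₁ X ⇔ (∀ i → ∣ X ∩ Class part i ∣ ≤ 1))
  (I : Subset n) (s : Fin n) (s∉I : s ∉ I) (iI₁ : Indep M₁ I) (iI₂ : Indep M₂ I)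
  (k : ℕ) (∣I∣≡k : ∣ I ∣ ≡ k) where

  open Setup M₁ M₂ I s
  open ExchangeGraph M₁ M₂ part indep₁⇔ I s s∉I iI₁ iI₂
  open Updates M₁ M₂ I s

  record WellFormed (P : State) : Set where
    field
      size   : ∀ {y Q} → P y ≡ just Q → ∣ I △ₗ Q ∣ ≡ k
      closed : ∀ {y Q w} → P y ≡ just Q → w L.∈ Q → w ∈ I → ∃[ Q′ ] P w ≡ just Q′

  size-∷ʳ-∉ : ∀ {Q x} → ∣ I △ₗ Q ∣ ≡ k → x ∉ I → ¬ x L.∈ Q → ∣ I △ₗ (Q ∷ʳ x) ∣ ≡ suc k
  size-∷ʳ-∉ {Q} size x∉I x∉Q = trans (∣△ₗ-∷ʳ-∉∣ I Q x∉I x∉Q) (cong suc size)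

  size-∷ʳ-∉-∈ : ∀ {Q x y} → ∣ I △ₗ Q ∣ ≡ k → x ∉ I → ¬ x L.∈ Q → y ∈ I → ¬ y L.∈ (Q ∷ʳ x) →
                ∣ I △ₗ (Q ++ x ∷ y ∷ []) ∣ ≡ k
  size-∷ʳ-∉-∈ {Q} {x} {y} size x∉I x∉Q y∈I y∉ = ℕ.suc-injective (begin-equality
    suc ∣ I △ₗ (Q ++ x ∷ y ∷ []) ∣ ≡⟨ cong (λ L → suc ∣ I △ₗ L ∣) (List.++-assoc Q [ x ] [ y ]) ⟨
    suc ∣ I △ₗ ((Q ∷ʳ x) ∷ʳ y) ∣  ≡⟨ ∣△ₗ-∷ʳ-∈∣ I (Q ∷ʳ x) y∈I y∉ ⟩
    ∣ I △ₗ (Q ∷ʳ x) ∣             ≡⟨ size-∷ʳ-∉ size x∉I x∉Q ⟩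
    suc k                         ∎)

  WellFormed-init : ∀ P → Init P → WellFormed P
  WellFormed-init P init = record { size = size ; closed = closed }
    where
    init-just : ∀ {y Q} → P y ≡ just Q → y ∈ I × Q ≡ s ∷ y ∷ []
    init-just {y} Py≡ with init y
    ... | inj₁ (y∈I , _ , Py≡′) = y∈I , just-injective (trans (sym Py≡) Py≡′)
    ... | inj₂ (_ , Py≡′) with trans (sym Py≡) Py≡′
    ...   | ()
    size : ∀ {y Q} → P y ≡ just Q → ∣ I △ₗ Q ∣ ≡ k
    size Py≡ with init-just Py≡
    ... | y∈I , refl = size-∷ʳ-∉-∈ {[]} (trans (cong ∣_∣ (△ₗ-[] I)) ∣I∣≡k) s∉I (λ ()) y∈I
                         (∉-∷ʳ {xs = []} (λ ()) (λ { refl → s∉I y∈I }))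
    closed : ∀ {y Q w} → P y ≡ just Q → w L.∈ Q → w ∈ I → ∃[ Q′ ] P w ≡ just Q′
    closed Py≡ w∈ w∈I with init-just Py≡
    ... | _ , refl with w∈
    ...   | here refl         = ⊥-elim (s∉I w∈I)
    ...   | there (here refl) = _ , Py≡

  WellFormed-step : ∀ {ℓ P} → WellFormed P → ∀ P′ → (∀ y → UpdAt ℓ P y (P′ y)) → WellFormed P′
  WellFormed-step {ℓ} {P} wf P′ upd =
    record { size = λ {y} → size′ (upd y) ; closed = λ {y} → closed′ (upd y) refl }
    where
    open WellFormed wf
    stays-set : ∀ {w Q} → P w ≡ just Q → ∃[ Q′ ] P′ w ≡ just Q′
    stays-set {w} {Q} Pw≡ = Q , UpdAt-just (upd w) Pw≡
    y∉-new : ∀ {y y′ x Q} → P y ≡ nothing → y ∈ I → Cond-iii ℓ P y y′ x Q → ¬ y L.∈ (Q ∷ʳ x)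
    y∉-new Py≡ y∈I ((_ , x∉I , PQ , _) , _) =
      ∉-∷ʳ (λ y∈Q → let (_ , Py≡′) = closed PQ y∈Q y∈I in case trans (sym Py≡′) Py≡ of λ ())
           (λ { refl → x∉I y∈I })
    size′ : ∀ {y m Q} → UpdAt ℓ P y m → m ≡ just Q → ∣ I △ₗ Q ∣ ≡ k
    size′ (keep _) Py≡ = size Py≡
    size′ (set y∈I Py≡ _ _ _ c@((_ , x∉I , PQ , _ , x∉Q , _) , _)) refl =
      size-∷ʳ-∉-∈ (size PQ) x∉I x∉Q y∈I (y∉-new Py≡ y∈I c)
    closed′ : ∀ {y m Q w} → UpdAt ℓ P y m → P′ y ≡ m → m ≡ just Q → w L.∈ Q → w ∈ I →
              ∃[ Q′ ] P′ w ≡ just Q′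
    closed′ (keep _) _ Py≡ w∈ w∈I = stays-set (proj₂ (closed Py≡ w∈ w∈I))
    closed′ (set y∈I Py≡ _ x Q ((_ , x∉I , PQ , _) , _)) P′y≡ refl w∈ w∈I with ∈-++⁻ Q w∈
    ... | inj₁ w∈Q                 = stays-set (proj₂ (closed PQ w∈Q w∈I))
    ... | inj₂ (here refl)         = ⊥-elim (x∉I w∈I)
    ... | inj₂ (there (here refl)) = _ , P′y≡

  record ShortestPaths (ℓ : ℕ) (P : State) : Set where
    field
      stored : ∀ {y Q} → P y ≡ just Q → Path Q y × length Q ≤ 2 * ℓ × Dist≥ (_≡ y) (length Q)
      found  : ∀ {y G} → y ∈ I → Path G y → length G ≤ 2 * ℓ → ∃[ Q ] P y ≡ just Q
      T-far  : Dist≥ T_I (suc (2 * ℓ))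

  module Iteration (s∈S : S_I s) (s∉T : ¬ T_I s) (ℓ : ℕ) (P : State) (1≤ℓ : 1 ≤ ℓ)
                   (wf : WellFormed P) (sp : ShortestPaths ℓ P) where

    open WellFormed wf
    open ShortestPaths sp

    stored-path : ∀ {y Q} → P y ≡ just Q → Path Q y
    stored-path PQ = proj₁ (stored PQ)

    stored-≤ : ∀ {y Q} → P y ≡ just Q → length Q ≤ 2 * ℓ
    stored-≤ PQ = proj₁ (proj₂ (stored PQ))

    unreached : ∀ {y G} → P y ≡ nothing → y ∈ I → Path G y → 2 * ℓ < length G
    unreached {G = G} Py≡ y∈I pg with length G ≤? 2 * ℓ
    ... | no  G≰ = ℕ.≰⇒> G≰
    ... | yes G≤ with found y∈I pg G≤
    ...   | _ , Py≡′ with trans (sym Py≡′) Py≡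
    ...     | ()

    unreached-far : ∀ {y} → P y ≡ nothing → y ∈ I → Dist≥ (_≡ y) (2 + 2 * ℓ)
    unreached-far Py≡ y∈I pg refl = Even-2ℓ<m⇒2+2ℓ≤m ℓ (Path-even pg y∈I) (unreached Py≡ y∈I pg)

    stored-avoids-T : ∀ {y Q e} → P y ≡ just Q → e L.∈ Q → ¬ T_I e
    stored-avoids-T PQ e∈Q e∈T with Path-prefix≤ (stored-path PQ) e∈Q
    ... | _ , pe , |Qe|≤ = ℕ.<⇒≱ (T-far pe e∈T) (ℕ.≤-trans |Qe|≤ (stored-≤ PQ))

    stored-avoids-unreached : ∀ {y y′ Q} → P y ≡ nothing → y ∈ I → P y′ ≡ just Q → ¬ y L.∈ Q
    stored-avoids-unreached Py≡ y∈I PQ y∈Q with Path-prefix≤ (stored-path PQ) y∈Q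
    ... | _ , py , |Qy|≤ = ℕ.<⇒≱ (unreached Py≡ y∈I py) (ℕ.≤-trans |Qy|≤ (stored-≤ PQ))

    -- Otherwise the arc (e, y) would reach y from a proper prefix of Q, within 2ℓ vertices.
    no-exchange-from-stored : ∀ {y y′ Q e} → P y ≡ nothing → y ∈ I → y′ ∈ I → P y′ ≡ just Q →
                              e L.∈ Q → e ∉ I → ¬ Indep M₂ (I ＋ e - y)
    no-exchange-from-stored {y} Py≡ y∈I y′∈I PQ e∈Q e∉I iI＋e-y with Path-prefix (stored-path PQ) e∈Q
    ... | inj₁ refl = e∉I y′∈I
    ... | inj₂ (Qe , pe , |Qe|<) with y ∈ₗ? Qe
    ...   | yes y∈Qe = let (_ , py , |Qy|≤) = Path-prefix≤ pe y∈Qe in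
                       ℕ.<⇒≱ (unreached Py≡ y∈I py) (ℕ.≤-trans |Qy|≤ (ℕ.≤-trans (ℕ.<⇒≤ |Qe|<) (stored-≤ PQ)))
    ...   | no  y∉Qe =
            ℕ.<⇒≱ (unreached Py≡ y∈I (snoc pe (D′-into-I e∉I y∈I iI＋e-y (stored-avoids-T PQ e∈Q)) y∉Qe))
                  (ℕ.≤-trans (ℕ.≤-reflexive (length-∷ʳ Qe y)) (ℕ.≤-trans |Qe|< (stored-≤ PQ)))

    step-ii-complete : ∀ {G t} → Path G t → T_I t → length G ≡ suc (2 * ℓ) →
                       ∃[ y′ ] ∃[ x ] ∃[ Q ] Cond-ii ℓ P y′ x Q
    step-ii-complete start t∈T _ = ⊥-elim (s∉T t∈T)
    step-ii-complete (snoc {R} {y′} {t} p d _) t∈T |G|≡ = via (found y′∈I p (ℕ.≤-reflexive |R|≡))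
      where
      t∉I = proj₁ t∈T
      y′∈I = tail∈I d t∉I
      |R|≡ : length R ≡ 2 * ℓ
      |R|≡ = ℕ.suc-injective (trans (sym (length-∷ʳ R t)) |G|≡)
      via : ∃[ Q ] P y′ ≡ just Q → ∃[ y′ ] ∃[ x ] ∃[ Q ] Cond-ii ℓ P y′ x Q
      via (Q , PQ) =
        y′ , t , Q , (y′∈I , t∉I , PQ , |Q|≡ , t∉Q , same-class⇒¬CI y′∈I t∉I (sym (proj₂ (arc-from-I d y′∈I)))) ,
        (indep₁-along-path s∈S pQt , indep₂-along-shortest (stored-path PQ) y′∈I (step d done) t∈T disj iI△t dist)
        where
        t∉Q : ¬ t L.∈ Q
        t∉Q t∈Q = stored-avoids-T PQ t∈Q t∈T
        pQt = snoc (stored-path PQ) d t∉Q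
        |Q|≡ : length Q ≡ 2 * ℓ
        |Q|≡ = ℕ.≤-antisym (stored-≤ PQ) (ℕ.≤-pred (ℕ.≤-trans (T-far pQt t∈T) (ℕ.≤-reflexive (length-∷ʳ Q t))))
        disj : ∀ {z} → z L.∈ [ t ] → ¬ z L.∈ Q
        disj (here refl) = t∉Q
        iI△t : Indep M₂ (I △ₗ [ t ])
        iI△t = subst (Indep M₂) (sym (△ₗ-[x] I t∉I)) (proj₂ t∈T)
        dist : Dist≥ T_I (length Q + 1)
        dist = subst (Dist≥ T_I) (trans (cong suc (sym |Q|≡)) (ℕ.+-comm 1 (length Q))) T-far

    -- I △ (Q + x) is M₂-independent and larger than I, so I + e ∈ M₂ for some e on Q + x,
    -- and e = x since Q avoids T_I.
    step-ii-sound : ∀ {y′ x Q} → Cond-ii ℓ P y′ x Q → Path (Q ∷ʳ x) x × T_I x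
    step-ii-sound {y′} {x} {Q} ((y′∈I , x∉I , PQ , _ , x∉Q , ¬ci) , (_ , iI△Qx))
      with indep-aug M₂ iI₂ iI△Qx
             (subst (∣ I ∣ <_) (sym (size-∷ʳ-∉ (size PQ) x∉I x∉Q)) (s≤s (ℕ.≤-reflexive ∣I∣≡k)))
    ... | e , e∈ , e∉I , iI＋e with x∈p△q⁻ I (elems (Q ∷ʳ x)) e∈
    ...   | inj₁ (e∈I , _) = ⊥-elim (e∉I e∈I)
    ...   | inj₂ (_ , e∈Qx) with x∈elems-∷ʳ⁻ Q e∈Qx
    ...     | inj₁ e∈Q  = ⊥-elim (stored-avoids-T PQ e∈Q (e∉I , iI＋e))
    ...     | inj₂ refl = snoc (stored-path PQ) (D′-from-I y′∈I x∉I same-class) x∉Q , (x∉I , iI＋e)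
      where
      same-class = sym (¬CI⇒same-class ¬ci (x∈p⇒x∈p＋y x I y′∈I) (y∈p＋y x I) iI＋e)

    step-iii-complete : ∀ {y G} → y ∈ I → P y ≡ nothing → Path G y → length G ≡ 2 * suc ℓ →
                        ∃[ y′ ] ∃[ x ] ∃[ Q ] Cond-iii ℓ P y y′ x Q
    step-iii-complete y∈I Py≡ start _ = ⊥-elim (s∉I y∈I)
    step-iii-complete y∈I Py≡ p@(snoc start _ _) _ =
      ⊥-elim (ℕ.<⇒≱ (unreached Py≡ y∈I p) (ℕ.*-monoʳ-≤ 2 1≤ℓ))
    step-iii-complete {y} y∈I Py≡ (snoc (snoc {R} {y″} {x} p₂ d₂ _) d₁ _) |G|≡ =
      via (found y″∈I p₂ (ℕ.≤-reflexive |R|≡))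
      where
      x∉I = tail∉I d₁ y∈I
      y″∈I = tail∈I d₂ x∉I
      |R|≡ : length R ≡ 2 * ℓ
      |R|≡ = ℕ.suc-injective (ℕ.suc-injective (begin-equality
        2 + length R             ≡⟨ length-∷ʳ₂ R x y ⟨
        length ((R ∷ʳ x) ∷ʳ y)   ≡⟨ |G|≡ ⟩
        2 * suc ℓ                ≡⟨ ℕ.*-suc 2 ℓ ⟩
        2 + 2 * ℓ                ∎))
      via : ∃[ Q ] P y″ ≡ just Q → ∃[ y′ ] ∃[ x ] ∃[ Q ] Cond-iii ℓ P y y′ x Q
      via (Q , PQ) =
        y″ , x , Q , (y″∈I , x∉I , PQ , |Q|≡ , x∉Q , same-class⇒¬CI y″∈I x∉I (sym (proj₂ (arc-from-I d₂ y″∈I)))) ,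
        (subst (λ L → Indep M₁ (I △ₗ L)) (List.++-assoc Q [ x ] [ y ]) (indep₁-along-path s∈S pF) ,
         subst (λ L → Indep M₂ (I △ₗ L)) (trans (List.++-identityʳ _) (List.++-assoc Q [ x ] [ y ]))
           (indep₂-along-shortest pF y∈I done refl (λ ()) (subst (Indep M₂) (sym (△ₗ-[] I)) iI₂)
             (subst (Dist≥ (_≡ y)) (sym |F|≡) (unreached-far Py≡ y∈I))))
        where
        x∉Q : ¬ x L.∈ Q
        x∉Q x∈Q = no-exchange-from-stored Py≡ y∈I y″∈I PQ x∈Q x∉I (proj₁ (proj₂ (arc-into-I d₁ x∉I)))
        pF = snoc (snoc (stored-path PQ) d₂ x∉Q) d₁
                  (∉-∷ʳ (stored-avoids-unreached Py≡ y∈I PQ) (λ { refl → x∉I y∈I }))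
        |Q|≡ : length Q ≡ 2 * ℓ
        |Q|≡ = Even-m≤n≤1+m⇒m≡n (stored-≤ PQ)
                 (ℕ.≤-pred (subst (2 * ℓ <_) (length-∷ʳ₂ Q x y) (unreached Py≡ y∈I pF)))
                 (Path-even (stored-path PQ) y″∈I) (Even-2* ℓ)
        |F|≡ : length ((Q ∷ʳ x) ∷ʳ y) + length {A = Fin n} [] ≡ 2 + 2 * ℓ
        |F|≡ = trans (ℕ.+-identityʳ _) (trans (length-∷ʳ₂ Q x y) (cong (2 +_) |Q|≡))

    -- I - y augments from I △ F (F = Q + x + y) by some e with I + e - y ∈ M₂; e = x by
    -- no-exchange-from-stored, and the exchange (x, y) closes the path.
    step-iii-sound : ∀ {y y′ x Q} → ¬ (∃[ y′ ] ∃[ x ] ∃[ Q ] Cond-ii ℓ P y′ x Q) → y ∈ I → P y ≡ nothing →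
                     Cond-iii ℓ P y y′ x Q → Path ((Q ∷ʳ x) ∷ʳ y) y
    step-iii-sound {y} {y′} {x} {Q} no-ii y∈I Py≡ ((y′∈I , x∉I , PQ , |Q|≡ , x∉Q , ¬ci) , (_ , iI△F)) =
      exchanged-is-x (indep-aug M₂ (indep-↓ M₂ {I - y} (x∈p-y⇒x∈p I) iI₂) iI△F′ ∣I-y∣<∣I△F∣)
      where
      F = (Q ∷ʳ x) ∷ʳ y
      pQ = stored-path PQ
      y∉Q = stored-avoids-unreached Py≡ y∈I PQ
      y∉Qx : ¬ y L.∈ (Q ∷ʳ x)
      y∉Qx = ∉-∷ʳ y∉Q (λ { refl → x∉I y∈I })
      iI△F′ : Indep M₂ (I △ₗ F)
      iI△F′ = subst (λ L → Indep M₂ (I △ₗ L)) (sym (List.++-assoc Q [ x ] [ y ])) iI△F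
      ∣I-y∣<∣I△F∣ : ∣ I - y ∣ < ∣ I △ₗ F ∣
      ∣I-y∣<∣I△F∣ = ℕ.≤-reflexive (begin-equality
        suc ∣ I - y ∣               ≡⟨ x∈p⇒1+∣p-x∣≡∣p∣ I y∈I ⟩
        ∣ I ∣                       ≡⟨ ∣I∣≡k ⟩
        k                           ≡⟨ size-∷ʳ-∉-∈ (size PQ) x∉I x∉Q y∈I y∉Qx ⟨
        ∣ I △ₗ (Q ++ x ∷ y ∷ []) ∣  ≡⟨ cong (λ L → ∣ I △ₗ L ∣) (List.++-assoc Q [ x ] [ y ]) ⟨
        ∣ I △ₗ F ∣                  ∎)
      exchanged-is-x : ∃[ e ] (e ∈ I △ₗ F × e ∉ I - y × Indep M₂ ((I - y) ＋ e)) → Path F y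
      exchanged-is-x (e , e∈ , e∉I-y , iI-y＋e) with x∈p△q⁻ I (elems F) e∈
      ... | inj₁ (e∈I , e∉F) = ⊥-elim (e∉I-y (x∈p∧x≢y⇒x∈p-y e∈I (λ { refl → e∉F (a∈elems-∷ʳa y (Q ∷ʳ x)) })))
      ... | inj₂ (e∉I , e∈F) with x∈elems-∷ʳ⁻ (Q ∷ʳ x) e∈F
      ...   | inj₂ refl = ⊥-elim (e∉I y∈I)
      ...   | inj₁ e∈Qx with ∈-++⁻ Q e∈Qx
      ...     | inj₁ e∈Q  = ⊥-elim (no-exchange-from-stored Py≡ y∈I y′∈I PQ e∈Q e∉I iI＋e-y)
        where iI＋e-y = indep-↓ M₂ p＋x-y⊆p-y＋x iI-y＋e
      ...     | inj₂ (here refl) = snoc (snoc pQ d₁ x∉Q) d₂ y∉Qx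
        where
        y′∈I-y : y′ ∈ I - y
        y′∈I-y = x∈p∧x≢y⇒x∈p-y y′∈I (λ { refl → y∉Q (Path-last∈ pQ) })
        d₁ : D′ y′ x
        d₁ = D′-from-I y′∈I x∉I (sym (¬CI⇒same-class ¬ci (x∈p⇒x∈p＋y x (I - y) y′∈I-y) (y∈p＋y x (I - y)) iI-y＋e))
        x∉T : ¬ T_I x
        x∉T x∈T = no-ii (step-ii-complete (snoc pQ d₁ x∉Q) x∈T (trans (length-∷ʳ Q x) (cong suc |Q|≡)))
        d₂ : D′ x y
        d₂ = D′-into-I x∉I y∈I (indep-↓ M₂ p＋x-y⊆p-y＋x iI-y＋e) x∉T

    -- At length 2ℓ a path to T_I is in I and its prefix can be replaced by the stored path,
    -- which is strictly shorter when no stored path has length 2ℓ.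
    step-i-sound : ¬ (∃[ y ] (y ∈ I × HasLen ℓ P y)) → ∀ fuel {G t} → length G < fuel → Path G t → ¬ T_I t
    step-i-sound none (suc fuel) {G} G< p t∈T
      with Path-split p (2 * ℓ) (ℕ.≤-trans (s≤s z≤n) (ℕ.*-monoʳ-≤ 2 1≤ℓ)) (ℕ.≤-trans (ℕ.n≤1+n _) (T-far p t∈T))
    ... | R , u , L , pr , |R|≡ , wk , |R|+|L|≡ with u ∈? I
    ...   | no  u∉I = ¬Even∧Odd (Even-2* ℓ) (subst Odd |R|≡ (Path-odd pr u∉I))
    ...   | yes u∈I with found u∈I pr (ℕ.≤-reflexive |R|≡)
    ...     | Q , PQ with length Q ℕ.≟ 2 * ℓ
    ...       | yes |Q|≡ = none (u , u∈I , Q , PQ , |Q|≡)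
    ...       | no  |Q|≢ with shortcut (stored-path PQ) wk
    ...         | G′ , pg , G′≤ = step-i-sound none fuel G′< pg t∈T
      where
      |Q|<|R| : length Q < length R
      |Q|<|R| = subst (length Q <_) (sym |R|≡)
                  (ℕ.≤∧≢⇒< (ℕ.≤-trans (proj₂ (proj₂ (stored PQ)) pr refl) (ℕ.≤-reflexive |R|≡)) |Q|≢)
      G′< : length G′ < fuel
      G′< = begin-strict
        length G′             ≤⟨ G′≤ ⟩
        length Q + length L   <⟨ ℕ.+-monoˡ-< (length L) |Q|<|R| ⟩
        length R + length L   ≡⟨ |R|+|L|≡ ⟩
        length G              ≤⟨ ℕ.≤-pred G< ⟩
        fuel                  ∎

    stored-after : ¬ (∃[ y′ ] ∃[ x ] ∃[ Q ] Cond-ii ℓ P y′ x Q) → ∀ {y m Q} → UpdAt ℓ P y m → m ≡ just Q →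
                   Path Q y × length Q ≤ 2 * suc ℓ × Dist≥ (_≡ y) (length Q)
    stored-after _ (keep _) Py≡ =
      let (pQ , |Q|≤ , dist) = stored Py≡ in pQ , ℕ.≤-trans |Q|≤ (ℕ.*-monoʳ-≤ 2 (ℕ.n≤1+n ℓ)) , dist
    stored-after no-ii {y} (set y∈I Py≡ y′ x Q c@((_ , _ , _ , |Q|≡ , _) , _)) refl =
      subst (λ L → Path L y) F≡ (step-iii-sound no-ii y∈I Py≡ c) ,
      ℕ.≤-reflexive |F|≡ ,
      subst (Dist≥ (_≡ y)) (trans (sym (ℕ.*-suc 2 ℓ)) (sym |F|≡)) (unreached-far Py≡ y∈I)
      where
      F≡ : (Q ∷ʳ x) ∷ʳ y ≡ Q ++ x ∷ y ∷ []
      F≡ = List.++-assoc Q [ x ] [ y ]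
      |F|≡ : length (Q ++ x ∷ y ∷ []) ≡ 2 * suc ℓ
      |F|≡ = begin-equality
        length (Q ++ x ∷ y ∷ [])  ≡⟨ cong length F≡ ⟨
        length ((Q ∷ʳ x) ∷ʳ y)    ≡⟨ length-∷ʳ₂ Q x y ⟩
        2 + length Q              ≡⟨ cong (2 +_) |Q|≡ ⟩
        2 + 2 * ℓ                 ≡⟨ ℕ.*-suc 2 ℓ ⟨
        2 * suc ℓ                 ∎

    found-after : ∀ {y m G} → UpdAt ℓ P y m → y ∈ I → Path G y → length G ≤ 2 * suc ℓ → ∃[ Q ] m ≡ just Q
    found-after {y} (keep not-pending) y∈I _ _ with P y
    ... | just Q  = Q , refl
    ... | nothing = ⊥-elim (not-pending (y∈I , refl))
    found-after (set _ _ _ _ _ _) _ _ _ = _ , refl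
    found-after {G = G} (stay _ Py≡ no-iii) y∈I pg G≤ =
      ⊥-elim (no-iii (step-iii-complete y∈I Py≡ pg (ℕ.≤-antisym G≤
        (subst (_≤ length G) (sym (ℕ.*-suc 2 ℓ)) (unreached-far Py≡ y∈I pg refl)))))

    -- Paths to T_I have odd length, and one of length 2ℓ + 1 would have triggered step (ii).
    T-far-after : ¬ (∃[ y′ ] ∃[ x ] ∃[ Q ] Cond-ii ℓ P y′ x Q) → Dist≥ T_I (suc (2 * suc ℓ))
    T-far-after no-ii {G} pg t∈T with ℕ.m≤n⇒m<n∨m≡n (T-far pg t∈T)
    ... | inj₂ |G|≡ = ⊥-elim (no-ii (step-ii-complete pg t∈T (sym |G|≡)))
    ... | inj₁ 2+2ℓ≤ with ℕ.m≤n⇒m<n∨m≡n 2+2ℓ≤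
    ...   | inj₂ |G|≡ = ⊥-elim (¬Even∧Odd (subst Even (trans (ℕ.*-suc 2 ℓ) |G|≡) (Even-2* (suc ℓ)))
                                          (Path-odd pg (proj₁ t∈T)))
    ...   | inj₁ 3+2ℓ≤ = subst (λ m → suc m ≤ length G) (sym (ℕ.*-suc 2 ℓ)) 3+2ℓ≤

    ShortestPaths-step : ¬ (∃[ y′ ] ∃[ x ] ∃[ Q ] Cond-ii ℓ P y′ x Q) →
                         ∀ P′ → (∀ y → UpdAt ℓ P y (P′ y)) → ShortestPaths (suc ℓ) P′
    ShortestPaths-step no-ii P′ upd = record
      { stored = λ {y} → stored-after no-ii (upd y)
      ; found  = λ {y} → found-after (upd y)
      ; T-far  = T-far-after no-ii
      }

  ShortestPaths-init : S_I s → ¬ T_I s → ∀ P → Init P → ShortestPaths 1 P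
  ShortestPaths-init s∈S s∉T P init = record { stored = stored ; found = found ; T-far = T-far }
    where
    2≤snoc : ∀ {Q u v} → Path Q u → 2 ≤ length (Q ∷ʳ v)
    2≤snoc {Q} {v = v} p = subst (2 ≤_) (sym (length-∷ʳ Q v)) (s≤s (Path-length≥1 p))
    3≤snoc² : ∀ {Q u v w} → Path Q u → 3 ≤ length ((Q ∷ʳ v) ∷ʳ w)
    3≤snoc² {Q} {v = v} {w} p = subst (3 ≤_) (sym (length-∷ʳ₂ Q v w)) (s≤s (s≤s (Path-length≥1 p)))
    stored : ∀ {y Q} → P y ≡ just Q → Path Q y × length Q ≤ 2 × Dist≥ (_≡ y) (length Q)
    stored {y} Py≡ with init y
    ... | inj₂ (_ , Py≡′) with trans (sym Py≡) Py≡′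
    ...   | ()
    stored {y} Py≡ | inj₁ (y∈I , (_ , iI＋s-y) , Py≡′) with trans (sym Py≡) Py≡′
    ...   | refl = snoc start (D′-into-I s∉I y∈I iI＋s-y s∉T) (λ { (here refl) → s∉I y∈I }) , ℕ.≤-refl , dist
      where
      dist : Dist≥ (_≡ y) 2
      dist start         refl = ⊥-elim (s∉I y∈I)
      dist (snoc p _ _) refl = 2≤snoc p
    found : ∀ {y G} → y ∈ I → Path G y → length G ≤ 2 → ∃[ Q ] P y ≡ just Q
    found y∈I start _ = ⊥-elim (s∉I y∈I)
    found {y} y∈I (snoc start d _) _ with init y
    ... | inj₁ (_ , _ , Py≡) = _ , Py≡
    ... | inj₂ (¬ci , _) = ⊥-elim (¬ci (y∈I , indep-↓ M₁ (x∈p-y⇒x∈p (I ＋ s)) (proj₂ s∈S) ,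
                                        proj₁ (proj₂ (arc-into-I d s∉I))))
    found y∈I (snoc (snoc p _ _) _ _) |G|≤2 = ⊥-elim (ℕ.<⇒≱ (3≤snoc² p) |G|≤2)
    T-far : Dist≥ T_I 3
    T-far start                    t∈T = ⊥-elim (s∉T t∈T)
    T-far (snoc start d _)         t∈T = ⊥-elim (proj₁ t∈T (proj₁ (arc-into-I d s∉I)))
    T-far (snoc (snoc p _ _) _ _) _   = 3≤snoc² p

  ¬CI⇒s∉T : ¬ CI (I ＋ s) → S_I s → ¬ T_I s
  ¬CI⇒s∉T ¬ci s∈S s∈T = ¬ci (proj₂ s∈S , proj₂ s∈T)

  loop-correct : ∀ {ℓ P out} → Loop ℓ P out → 1 ≤ ℓ → WellFormed P →
                 (S_I s → ¬ T_I s → ShortestPaths ℓ P) → ¬ CI (I ＋ s) → Correct k out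
  loop-correct {ℓ} {P} (step-i none) 1≤ℓ wf sp ¬ci = inj₁ refl , no-path
    where
    no-path : S_I s → (∃[ Q ] STPath Q) → ∃[ P ] (No ≡ ret P × ShortestSTPath P)
    no-path s∈S (_ , st) =
      let (G , t , pg , t∈T , _) = STPath⇒Path st
          s∉T = ¬CI⇒s∉T ¬ci s∈S
      in ⊥-elim (Iteration.step-i-sound s∈S s∉T ℓ P 1≤ℓ wf (sp s∈S s∉T) none (suc (length G)) ℕ.≤-refl pg t∈T)
  loop-correct {ℓ} {P} (step-ii _ y′ x Q c@((_ , x∉I , PQ , |Q|≡ , x∉Q , _) , ci)) 1≤ℓ wf sp ¬ci =
    inj₂ (Q ∷ʳ x , refl , ci , size-∷ʳ-∉ (WellFormed.size wf PQ) x∉I x∉Q) , shortest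
    where
    shortest : S_I s → (∃[ Q ] STPath Q) → ∃[ P′ ] (ret (Q ∷ʳ x) ≡ ret P′ × ShortestSTPath P′)
    shortest s∈S _ = Q ∷ʳ x , refl , Path⇒STPath pQx x∈T , no-shorter
      where
      s∉T = ¬CI⇒s∉T ¬ci s∈S
      sp′ = sp s∈S s∉T
      pQx-x∈T = Iteration.step-ii-sound s∈S s∉T ℓ P 1≤ℓ wf sp′ c
      pQx = proj₁ pQx-x∈T
      x∈T = proj₂ pQx-x∈T
      no-shorter : ∀ Q′ → STPath Q′ → length (Q ∷ʳ x) ≤ length Q′
      no-shorter Q′ st = let (G , t , pg , t∈T , |G|≤) = STPath⇒Path st in begin
        length (Q ∷ʳ x) ≡⟨ trans (length-∷ʳ Q x) (cong suc |Q|≡) ⟩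
        suc (2 * ℓ)     ≤⟨ ShortestPaths.T-far sp′ pg t∈T ⟩
        length G        ≤⟨ |G|≤ ⟩
        length Q′       ∎
  loop-correct {ℓ} {P} (step-iii _ no-ii P′ upd lp) 1≤ℓ wf sp ¬ci =
    loop-correct lp (s≤s z≤n) (WellFormed-step wf P′ upd)
      (λ s∈S s∉T → Iteration.ShortestPaths-step s∈S s∉T ℓ P 1≤ℓ wf (sp s∈S s∉T) no-ii P′ upd) ¬ci

  run-correct : ∀ {out} → Run out → Correct k out
  run-correct (step-1 ci) =
    inj₂ ([ s ] , refl , subst CI (sym (△ₗ-[x] I s∉I)) ci ,
          trans (cong ∣_∣ (△ₗ-[x] I s∉I)) (trans (x∉p⇒∣p＋x∣≡1+∣p∣ I s∉I) (cong suc ∣I∣≡k))) ,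
    λ _ _ → [ s ] , refl , Path⇒STPath start (s∉I , proj₂ ci) , λ { Q′ ((_ , refl) , _) → s≤s z≤n }
  run-correct (step-2-3 ¬ci P init lp) =
    loop-correct lp ℕ.≤-refl (WellFormed-init P init) (λ s∈S s∉T → ShortestPaths-init s∈S s∉T P init) ¬ci

-- Termination

module _ {A : Set} where

  ∣nothing∣ : Maybe A → ℕ
  ∣nothing∣ nothing  = 1
  ∣nothing∣ (just _) = 0

  #nothing : ∀ {m} → (Fin m → Maybe A) → ℕ
  #nothing {zero}  f = 0
  #nothing {suc m} f = ∣nothing∣ (f zero) + #nothing (f ∘ suc)

  #nothing≤ : ∀ {m} (f : Fin m → Maybe A) → #nothing f ≤ m
  #nothing≤ {zero}  f = z≤n
  #nothing≤ {suc m} f with f zero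
  ... | nothing = s≤s (#nothing≤ (f ∘ suc))
  ... | just _  = ℕ.m≤n⇒m≤1+n (#nothing≤ (f ∘ suc))

  ∣nothing∣-mono : ∀ (a b : Maybe A) → (b ≡ nothing → a ≡ nothing) → ∣nothing∣ b ≤ ∣nothing∣ a
  ∣nothing∣-mono _        (just _) _   = z≤n
  ∣nothing∣-mono nothing  nothing  _   = ℕ.≤-refl
  ∣nothing∣-mono (just _) nothing  b⇒a with b⇒a refl
  ... | ()

  #nothing-mono : ∀ {m} (f g : Fin m → Maybe A) → (∀ y → g y ≡ nothing → f y ≡ nothing) →
                  #nothing g ≤ #nothing f
  #nothing-mono {zero}  f g g⇒f = z≤n
  #nothing-mono {suc m} f g g⇒f =
    ℕ.+-mono-≤ (∣nothing∣-mono (f zero) (g zero) (g⇒f zero)) (#nothing-mono (f ∘ suc) (g ∘ suc) (g⇒f ∘ suc))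

  #nothing-< : ∀ {m} (f g : Fin m → Maybe A) → (∀ y → g y ≡ nothing → f y ≡ nothing) →
               ∀ y {a} → f y ≡ nothing → g y ≡ just a → #nothing g < #nothing f
  #nothing-< f g g⇒f zero fy≡ gy≡ with f zero | g zero
  #nothing-< f g g⇒f zero refl refl | nothing | just _ = s≤s (#nothing-mono (f ∘ suc) (g ∘ suc) (g⇒f ∘ suc))
  #nothing-< f g g⇒f (suc y) fy≡ gy≡ =
    ℕ.+-mono-≤-< (∣nothing∣-mono (f zero) (g zero) (g⇒f zero))
                 (#nothing-< (f ∘ suc) (g ∘ suc) (g⇒f ∘ suc) y fy≡ gy≡)

module Termination (M₁ M₂ : Matroid n) (I : Subset n) (s : Fin n) where

  open Setup M₁ M₂ I s
  open Updates M₁ M₂ I s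

  CI? : ∀ X → Dec (CI X)
  CI? X = indep? M₁ X ×-dec indep? M₂ X

  nothing? : ∀ {A : Set} (m : Maybe A) → Dec (m ≡ nothing)
  nothing? nothing  = yes refl
  nothing? (just _) = no (λ ())

  stored-at? : ∀ (m : Maybe (List (Fin n))) {B : List (Fin n) → Set} → (∀ Q → Dec (B Q)) →
               Dec (∃[ Q ] (m ≡ just Q × B Q))
  stored-at? nothing  _  = no (λ { (_ , () , _) })
  stored-at? (just Q) B? = Dec.map′ (λ b → Q , refl , b) (λ { (_ , refl , b) → b }) (B? Q)

  base? : ∀ ℓ P (C : Fin n → Fin n → List (Fin n) → Set) → (∀ y′ x Q → Dec (C y′ x Q)) →
          Dec (∃[ y′ ] ∃[ x ] ∃[ Q ] (Base ℓ P y′ x Q × C y′ x Q))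
  base? ℓ P C C? = Fin.any? λ y′ → Fin.any? λ x → Dec.map′ to from (stored-at? (P y′) (B? y′ x))
    where
    B? : ∀ y′ x Q → Dec (y′ ∈ I × x ∉ I × length Q ≡ 2 * ℓ × ¬ x L.∈ Q × ¬ CI (⁅ y′ ⁆ ∪ ⁅ x ⁆) × C y′ x Q)
    B? y′ x Q = y′ ∈? I ×-dec ¬? (x ∈? I) ×-dec length Q ℕ.≟ 2 * ℓ ×-dec ¬? (x ∈ₗ? Q) ×-dec
                ¬? (CI? _) ×-dec C? y′ x Q
    to : ∀ {y′ x} → _ → ∃[ Q ] (Base ℓ P y′ x Q × C y′ x Q)
    to (Q , Py′≡ , (a , b , c , d , e , r)) = Q , (a , b , Py′≡ , c , d , e) , r
    from : ∀ {y′ x} → ∃[ Q ] (Base ℓ P y′ x Q × C y′ x Q) → _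
    from (Q , (a , b , Py′≡ , c , d , e) , r) = Q , Py′≡ , (a , b , c , d , e , r)

  Cond-ii? : ∀ ℓ P → Dec (∃[ y′ ] ∃[ x ] ∃[ Q ] Cond-ii ℓ P y′ x Q)
  Cond-ii? ℓ P = base? ℓ P _ (λ _ x Q → CI? (I △ₗ (Q ∷ʳ x)))

  Cond-iii? : ∀ ℓ P y → Dec (∃[ y′ ] ∃[ x ] ∃[ Q ] Cond-iii ℓ P y y′ x Q)
  Cond-iii? ℓ P y = base? ℓ P _ (λ _ x Q → CI? (I △ₗ (Q ++ x ∷ y ∷ [])))

  HasLen? : ∀ ℓ P → Dec (∃[ y ] (y ∈ I × HasLen ℓ P y))
  HasLen? ℓ P = Fin.any? λ y → y ∈? I ×-dec stored-at? (P y) (λ Q → length Q ℕ.≟ 2 * ℓ)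

  update : ∀ ℓ P y → ∃[ m ] UpdAt ℓ P y m
  update ℓ P y with y ∈? I ×-dec nothing? (P y)
  ... | no  not-pending = P y , keep not-pending
  ... | yes (y∈I , Py≡) with Cond-iii? ℓ P y
  ...   | yes (y′ , x , Q , c) = just (Q ++ x ∷ y ∷ []) , set y∈I Py≡ y′ x Q c
  ...   | no  no-iii           = nothing , stay y∈I Py≡ no-iii

  Bounded : ℕ → State → Set
  Bounded ℓ P = ∀ {y Q} → P y ≡ just Q → length Q ≤ 2 * ℓ

  Bounded-step : ∀ {ℓ P y m} → Bounded ℓ P → UpdAt ℓ P y m → ∀ {Q} → m ≡ just Q → length Q ≤ 2 * suc ℓ
  Bounded-step {ℓ} bounded (keep _) Py≡ = ℕ.≤-trans (bounded Py≡) (ℕ.*-monoʳ-≤ 2 (ℕ.n≤1+n ℓ))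
  Bounded-step {ℓ} {y = y} _ (set _ _ _ x Q ((_ , _ , _ , |Q|≡ , _) , _)) refl = ℕ.≤-reflexive (begin-equality
    length (Q ++ x ∷ y ∷ []) ≡⟨ List.length-++ Q ⟩
    length Q + 2              ≡⟨ cong (_+ 2) |Q|≡ ⟩
    2 * ℓ + 2                 ≡⟨ ℕ.+-comm (2 * ℓ) 2 ⟩
    2 + 2 * ℓ                 ≡⟨ ℕ.*-suc 2 ℓ ⟨
    2 * suc ℓ                 ∎)

  just? : ∀ {A : Set} (m : Maybe A) → Dec (∃[ a ] m ≡ just a)
  just? nothing  = no (λ { (_ , ()) })
  just? (just a) = yes (a , refl)

  -- Every iteration that continues sets some P_y, so #nothing P decreases; once no P_y is set,
  -- all stored paths are shorter than 2(ℓ + 1) and step (i) ends the procedure.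
  loop-exists : ∀ fuel ℓ P → #nothing P < fuel → Bounded ℓ P → ∃[ out ] Loop ℓ P out
  loop-exists (suc fuel) ℓ P #< bounded with HasLen? ℓ P | Cond-ii? ℓ P
  ... | no  none | _                    = No , step-i none
  ... | yes some | yes (y′ , x , Q , c) = ret (Q ∷ʳ x) , step-ii some y′ x Q c
  ... | yes some | no  no-ii            = continue
    where
    P′ : State
    P′ y = proj₁ (update ℓ P y)
    upd : ∀ y → UpdAt ℓ P y (P′ y)
    upd y = proj₂ (update ℓ P y)
    bounded′ : Bounded (suc ℓ) P′
    bounded′ {y} = Bounded-step bounded (upd y)
    continue : ∃[ out ] Loop ℓ P out
    continue with Fin.any? (λ y → nothing? (P y) ×-dec just? (P′ y))
    ... | yes (y , Py≡ , _ , P′y≡) =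
      let (out , lp) = loop-exists fuel (suc ℓ) P′
                         (ℕ.≤-trans (#nothing-< P P′ (λ y → UpdAt-nothing (upd y)) y Py≡ P′y≡) (ℕ.≤-pred #<))
                         (λ {y} → bounded′ {y})
      in out , step-iii some no-ii P′ upd lp
    ... | no unchanged = No , step-iii some no-ii P′ upd (step-i none′)
      where
      none′ : ¬ (∃[ y ] (y ∈ I × HasLen (suc ℓ) P′ y))
      none′ (y , _ , Q , P′y≡ , |Q|≡) = was (P y) refl
        where
        was : ∀ m → ¬ P y ≡ m
        was nothing  Py≡ = unchanged (y , Py≡ , Q , P′y≡)
        was (just _) Py≡ with trans (sym (UpdAt-just (upd y) Py≡)) P′y≡
        ... | refl = ℕ.<⇒≱ (subst (2 * ℓ <_) (sym (ℕ.*-suc 2 ℓ)) (ℕ.m≤n⇒m≤1+n (ℕ.n<1+n (2 * ℓ))))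
                       (ℕ.≤-trans (ℕ.≤-reflexive (sym |Q|≡)) (bounded Py≡))

  run-exists : ∃[ out ] Run out
  run-exists with CI? (I ＋ s)
  ... | yes ci = ret [ s ] , step-1 ci
  ... | no ¬ci = let (out , lp) = loop-exists (suc n) 1 P₀ (s≤s (#nothing≤ P₀)) (λ {y} → bounded₀ {y}) in
                 out , step-2-3 ¬ci P₀ (proj₂ ∘ initial) lp
    where
    initial : ∀ y → ∃[ m ] ((y ∈ I × CI (I ＋ s - y) × m ≡ just (s ∷ y ∷ [])) ⊎
                            (¬ (y ∈ I × CI (I ＋ s - y)) × m ≡ nothing))
    initial y with y ∈? I ×-dec CI? (I ＋ s - y)
    ... | yes (y∈I , ci) = just (s ∷ y ∷ []) , inj₁ (y∈I , ci , refl)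
    ... | no  ¬c         = nothing , inj₂ (¬c , refl)
    P₀ : State
    P₀ = proj₁ ∘ initial
    bounded₀ : Bounded 1 P₀
    bounded₀ {y} P₀y≡ with initial y
    ... | _ , inj₁ (_ , _ , refl) with P₀y≡
    ...   | refl = ℕ.≤-refl
    bounded₀ {y} P₀y≡ | _ , inj₂ (_ , refl) with P₀y≡
    ...   | ()

lemma5p2 : ∀ {n} (M₁ M₂ : Matroid n) → Loopless M₁ → Loopless M₂ →
           IsPartitionAllOne M₁ →
           (k : ℕ) (I : Subset n) (s : Fin n) →
           Setup.CI M₁ M₂ I s I → ∣ I ∣ ≡ k → s ∉ I →
           (∃[ out ] Setup.Run M₁ M₂ I s out)
           × (∀ out → Setup.Run M₁ M₂ I s out → Setup.Correct M₁ M₂ I s k out)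
lemma5p2 M₁ M₂ _ _ (_ , part , indep₁⇔) k I s (iI₁ , iI₂) ∣I∣≡k s∉I =
  Termination.run-exists M₁ M₂ I s ,
  λ _ → Correctness.run-correct M₁ M₂ part indep₁⇔ I s s∉I iI₁ iI₂ k ∣I∣≡k
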